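{- For $n\ge 0$ let $T_n$ be the total number of lattice points lying on the $x$-axis, summed over all symmetric Dyck paths from $(0,0)$ to $(2n,0)$. Then $$\sum_{n\ge 0}T_nx^n=2\,C(x^2)\cdot\frac{1}{2x}\left(\sqrt{\frac{1+2x}{1-2x}}-1\right)-C(x^2)=1+2x+5x^2+8x^3+18x^4+30x^5+65x^6+\cdots.$$ Moreover, $\sum_{m\ge0}T_{2m}x^{2m}=C(x^2)\bigl(2B(x^2)-1\bigr)=1+5x^2+18x^4+65x^6+\cdots$, and the average number of points on the $x$-axis of a symmetric Dyck path of length $4m$ is $$\frac{\binom{2m+2}{m+1}-\frac{1}{m+1}\binom{2m}{m}}{\binom{2m}{m}}=\frac{4m+1}{m+1}\to 4;$$ while $\sum_{m\ge0}T_{2m+1}x^{2m+1}=2xB(x^2)C(x^2)^2=2x+8x^3+30x^5+112x^7+\cdots$, and the average number of points on the $x$-axis of a symmetric Dyck path of length $4m+2$ is $$\frac{2\binom{2m+2}{m}}{\binom{2m+1}{m}}=\frac{4(m+1)}{m+2}\to 4\quad(m\to\infty).$$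
   Context: A Dyck path of length $2n$ is a lattice path from $(0,0)$ to $(2n,0)$ with steps $U=(1,1)$, $D=(1,-1)$ never going below the $x$-axis. It is symmetric if its part on $[n,2n]$ is the mirror image of its part on $[0,n]$ under the reflection $x\mapsto 2n-x$. There are $\binom{n}{\lfloor n/2\rfloor}$ symmetric Dyck paths of length $2n$. $C(x)=\frac{1-\sqrt{1-4x}}{2x}$ and $B(x)=\frac{1}{\sqrt{1-4x}}=\sum_{n\ge0}\binom{2n}{n}x^n$. -}

module Defs where

open import Data.Bool using (if_then_else_)
open import Data.Nat as ℕ using (ℕ; zero; suc; _≤ᵇ_; _∸_)
open import Data.Nat.Combinatorics using (_C_)
open import Data.Integer as ℤ using (ℤ; +_; 0ℤ; 1ℤ)
import Data.Integer.Properties as ℤP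
open import Data.Rational as ℚ using (ℚ; 0ℚ; 1ℚ; ½; _/_)
open import Data.List using (List; []; _∷_; _++_; map; filter; length; reverse)
open import Data.Nat.ListAction using (sum)
open import Data.List.Relation.Unary.All using (All; all?)
import Data.List.Properties as LP
open import Data.Product using (_×_)
open import Relation.Nullary using (Dec)
open import Relation.Nullary.Decidable using (_×-dec_)
open import Relation.Binary.PropositionalEquality using (_≡_)

data Step : Set where
  U D : Step

Path : Set
Path = List Step

-- heights of the lattice points of a path started at height h
-- (a path with k steps has k+1 lattice points)
heightsFrom : ℤ → Path → List ℤ
heightsFrom h []       = h ∷ []
heightsFrom h (U ∷ p)  = h ∷ heightsFrom (h ℤ.+ 1ℤ) p
heightsFrom h (D ∷ p)  = h ∷ heightsFrom (h ℤ.- 1ℤ) p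

heights : Path → List ℤ
heights = heightsFrom 0ℤ

endHeightFrom : ℤ → Path → ℤ
endHeightFrom h []      = h
endHeightFrom h (U ∷ p) = endHeightFrom (h ℤ.+ 1ℤ) p
endHeightFrom h (D ∷ p) = endHeightFrom (h ℤ.- 1ℤ) p

IsDyck : Path → Set
IsDyck p = All (λ h → 0ℤ ℤ.≤ h) (heights p) × endHeightFrom 0ℤ p ≡ 0ℤ

-- the path on [n,2n] is the mirror image of the path on [0,n]:
-- height(x) = height(2n - x) for all lattice points x
IsSymmetric : Path → Set
IsSymmetric p = heights p ≡ reverse (heights p)

isDyck? : (p : Path) → Dec (IsDyck p)
isDyck? p = all? (λ h → 0ℤ ℤ.≤? h) (heights p) ×-dec (endHeightFrom 0ℤ p ℤ.≟ 0ℤ)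

isSymmetric? : (p : Path) → Dec (IsSymmetric p)
isSymmetric? p = LP.≡-dec ℤ._≟_ (heights p) (reverse (heights p))

allPaths : ℕ → List Path
allPaths zero    = [] ∷ []
allPaths (suc k) = map (U ∷_) (allPaths k) ++ map (D ∷_) (allPaths k)

symDyck : ℕ → List Path
symDyck n = filter (λ p → isDyck? p ×-dec isSymmetric? p) (allPaths (2 ℕ.* n))

axisPoints : Path → ℕ
axisPoints p = length (filter (ℤ._≟ 0ℤ) (heights p))

T : ℕ → ℕ
T n = sum (map axisPoints (symDyck n))

symCount : ℕ → ℕ
symCount n = length (symDyck n)

fromℕ : ℕ → ℚ
fromℕ n = + n / 1

-- division of a rational by a natural number (by convention p/0 = 0)
divℕ : ℚ → ℕ → ℚ
divℕ p zero    = 0ℚ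
divℕ p (suc k) = p ℚ.* (+ 1 / suc k)

average : ℕ → ℚ
average n = divℕ (fromℕ (T n)) (symCount n)

FPS : Set
FPS = ℕ → ℚ

_≈ₛ_ : FPS → FPS → Set
f ≈ₛ g = ∀ n → f n ≡ g n

sumTo : ℕ → (ℕ → ℚ) → ℚ
sumTo zero    g = 0ℚ
sumTo (suc n) g = sumTo n g ℚ.+ g n

constₛ : ℚ → FPS
constₛ c zero    = c
constₛ c (suc n) = 0ℚ

oneₛ : FPS
oneₛ = constₛ 1ℚ

Xₛ : FPS
Xₛ (suc zero) = 1ℚ
Xₛ _          = 0ℚ

_⊕_ : FPS → FPS → FPS
(f ⊕ g) n = f n ℚ.+ g n

_⊖_ : FPS → FPS → FPS
(f ⊖ g) n = f n ℚ.- g n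

_·ₛ_ : ℚ → FPS → FPS
(c ·ₛ f) n = c ℚ.* f n

_⊛_ : FPS → FPS → FPS
(f ⊛ g) n = sumTo (suc n) (λ i → f i ℚ.* g (n ∸ i))

infixl 7 _⊛_ _·ₛ_
infixl 6 _⊕_ _⊖_
infix 4 _≈ₛ_

-- (f - f(0)) / x
divX : FPS → FPS
divX f n = f (suc n)

-- substitution x ↦ x²:  sq f = f(x²)
sq : FPS → FPS
sq f zero          = f zero
sq f (suc zero)    = 0ℚ
sq f (suc (suc n)) = sq (λ k → f (suc k)) n

-- Square root of a series f with f(0) = 1: the unique series s with
-- s(0) = 1 and s² = f, computed by the usual coefficient recursion
-- s(n+1) = (f(n+1) - Σ_{i=1}^{n} s(i) s(n+1-i)) / 2.
-- sqrtPre f n agrees with the square root on coefficients 0..n.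
sqrtPre : FPS → ℕ → FPS
sqrtPre f zero    = λ _ → 1ℚ
sqrtPre f (suc n) = λ k → if k ≤ᵇ n then s k else c
  where
  s : FPS
  s = sqrtPre f n
  c : ℚ
  c = (f (suc n) ℚ.- sumTo n (λ j → s (suc j) ℚ.* s (n ∸ j))) ℚ.* ½

sqrtₛ : FPS → FPS
sqrtₛ f n = sqrtPre f n n

-- Multiplicative inverse of a series f with f(0) = 1:
-- v(0) = 1, v(n+1) = - Σ_{i=1}^{n+1} f(i) v(n+1-i).
invPre : FPS → ℕ → FPS
invPre f zero    = λ _ → 1ℚ
invPre f (suc n) = λ k → if k ≤ᵇ n then v k else c
  where
  v : FPS
  v = invPre f n
  c : ℚ
  c = ℚ.- sumTo (suc n) (λ j → f (suc j) ℚ.* v (n ∸ j))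

invₛ : FPS → FPS
invₛ f n = invPre f n n

Cₛ : FPS
Cₛ = ½ ·ₛ divX (oneₛ ⊖ sqrtₛ (oneₛ ⊖ fromℕ 4 ·ₛ Xₛ))

Bₛ : FPS
Bₛ n = fromℕ ((2 ℕ.* n) C n)

Tₛ : FPS
Tₛ n = fromℕ (T n)

module Submission where

-- A path of length 2n is a symmetric Dyck path iff it is
-- p ++ mirror p for a first half p that never goes below the axis, and such a
-- path meets the axis twice for every visit of p before its end, plus once in
-- the middle if p ends on the axis.  Hence symCount n = paths⁺ n 0 and
-- T n = 2 visits n 0 + returns n 0, where paths⁺, returns and visits count the
-- nonnegative paths, those ending on the axis, and their earlier axis visits.
-- Their step recursions, the reflection principle and a decomposition at
-- each visit give visits n = Σ_t returns t · paths⁺ (n - t), returns (2m) =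
-- Catalan, returns (2m+1) = 0, paths⁺ (2m) = C(2m,m), paths⁺ (2m+1) = C(2m+1,m).
--
-- In formal power series over ℚ we show B² = 1/(1-4x) (the central
-- binomial convolution), so sqrt(1-4x) = (1-4x) B and sqrt((1+2x)/(1-2x)) =
-- (1+2x) B(x²).  This identifies Σ returns n xⁿ = C(x²) and P(x) = Σ paths⁺ n xⁿ
-- = (sqrt((1+2x)/(1-2x)) - 1)/(2x), so T(x) = 2 C(x²) P(x) - C(x²).  Its even
-- and odd coefficients, divided by symCount, give the averages, and the
-- distance c/(m+1) of the averages to 4 gives the limits.

open import Defs
open import Relation.Binary.PropositionalEquality
open import Function using (_∘_)

module PathGeometry where
  open import Data.Integer as ℤ using (ℤ; 0ℤ; 1ℤ)
  open import Data.Integer.Tactic.RingSolver using (solve-∀)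
  open import Data.List using (List; []; _∷_; _++_; map; reverse; length; _∷ʳ_)
  import Data.List.Properties as LP
  open import Data.Product using (∃; _,_)
  open import Data.Empty using (⊥-elim)
  open ≡-Reasoning

  move : Step → ℤ → ℤ
  move U h = h ℤ.+ 1ℤ
  move D h = h ℤ.- 1ℤ

  heightsFrom-∷ : ∀ h s p → heightsFrom h (s ∷ p) ≡ h ∷ heightsFrom (move s h) p
  heightsFrom-∷ h U p = refl
  heightsFrom-∷ h D p = refl

  endHeightFrom-∷ : ∀ h s p → endHeightFrom h (s ∷ p) ≡ endHeightFrom (move s h) p
  endHeightFrom-∷ h U p = refl
  endHeightFrom-∷ h D p = refl

  initialHeights : ℤ → Path → List ℤ
  initialHeights h []      = []
  initialHeights h (s ∷ p) = h ∷ initialHeights (move s h) p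

  heightsFrom-split : ∀ h p → heightsFrom h p ≡ initialHeights h p ∷ʳ endHeightFrom h p
  heightsFrom-split h []      = refl
  heightsFrom-split h (U ∷ p) = cong (h ∷_) (heightsFrom-split _ p)
  heightsFrom-split h (D ∷ p) = cong (h ∷_) (heightsFrom-split _ p)

  heightsFrom-++ : ∀ h p q →
    heightsFrom h (p ++ q) ≡ initialHeights h p ++ heightsFrom (endHeightFrom h p) q
  heightsFrom-++ h []      q = refl
  heightsFrom-++ h (U ∷ p) q = cong (h ∷_) (heightsFrom-++ _ p q)
  heightsFrom-++ h (D ∷ p) q = cong (h ∷_) (heightsFrom-++ _ p q)

  endHeightFrom-++ : ∀ h p q → endHeightFrom h (p ++ q) ≡ endHeightFrom (endHeightFrom h p) q
  endHeightFrom-++ h []      q = refl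
  endHeightFrom-++ h (U ∷ p) q = endHeightFrom-++ _ p q
  endHeightFrom-++ h (D ∷ p) q = endHeightFrom-++ _ p q

  increment : ∀ s h → move s h ℤ.- h ≡ move s 0ℤ
  increment U h = up h
    where
    up : ∀ h → h ℤ.+ 1ℤ ℤ.- h ≡ 0ℤ ℤ.+ 1ℤ
    up = solve-∀
  increment D h = down h
    where
    down : ∀ h → h ℤ.- 1ℤ ℤ.- h ≡ 0ℤ ℤ.- 1ℤ
    down = solve-∀

  flip : Step → Step
  flip U = D
  flip D = U

  move-flip : ∀ s h → move (flip s) (move s h) ≡ h
  move-flip U h = up-down h
    where
    up-down : ∀ h → h ℤ.+ 1ℤ ℤ.- 1ℤ ≡ h
    up-down = solve-∀
  move-flip D h = down-up h
    where
    down-up : ∀ h → h ℤ.- 1ℤ ℤ.+ 1ℤ ≡ h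
    down-up = solve-∀

  mirror : Path → Path
  mirror p = reverse (map flip p)

  mirror-∷ : ∀ s p → mirror (s ∷ p) ≡ mirror p ∷ʳ flip s
  mirror-∷ s p = LP.unfold-reverse (flip s) (map flip p)

  mirror-++ : ∀ p q → mirror (p ++ q) ≡ mirror q ++ mirror p
  mirror-++ p q = trans (cong reverse (LP.map-++ flip p q)) (LP.reverse-++ (map flip p) (map flip q))

  mirror-involutive : ∀ p → mirror (mirror p) ≡ p
  mirror-involutive p = begin
    reverse (map flip (reverse (map flip p)))  ≡⟨ cong reverse (LP.reverse-map flip (map flip p)) ⟩
    reverse (reverse (map flip (map flip p)))  ≡⟨ LP.reverse-involutive _ ⟩
    map flip (map flip p)                      ≡⟨ LP.map-∘ p ⟨
    map (flip ∘ flip) p                        ≡⟨ LP.map-cong flip-flip p ⟩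
    map (λ s → s) p                            ≡⟨ LP.map-id p ⟩
    p                                          ∎
    where
    flip-flip : ∀ s → flip (flip s) ≡ s
    flip-flip U = refl
    flip-flip D = refl

  length-mirror : ∀ p → length (mirror p) ≡ length p
  length-mirror p = trans (LP.length-reverse (map flip p)) (LP.length-map flip p)

  endHeightFrom-mirror : ∀ h p → endHeightFrom (endHeightFrom h p) (mirror p) ≡ h
  endHeightFrom-mirror h []      = refl
  endHeightFrom-mirror h (s ∷ p) = begin
    endHeightFrom (endHeightFrom h (s ∷ p)) (mirror (s ∷ p))
      ≡⟨ cong₂ endHeightFrom (endHeightFrom-∷ h s p) (mirror-∷ s p) ⟩
    endHeightFrom e (mirror p ∷ʳ flip s)
      ≡⟨ endHeightFrom-++ e (mirror p) (flip s ∷ []) ⟩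
    endHeightFrom (endHeightFrom e (mirror p)) (flip s ∷ [])
      ≡⟨ cong (λ x → endHeightFrom x (flip s ∷ [])) (endHeightFrom-mirror (move s h) p) ⟩
    endHeightFrom (move s h) (flip s ∷ [])
      ≡⟨ endHeightFrom-∷ (move s h) (flip s) [] ⟩
    move (flip s) (move s h)
      ≡⟨ move-flip s h ⟩
    h ∎
    where e = endHeightFrom (move s h) p

  heightsFrom-mirror : ∀ h p → heightsFrom (endHeightFrom h p) (mirror p) ≡ reverse (heightsFrom h p)
  heightsFrom-mirror h []      = refl
  heightsFrom-mirror h (s ∷ p) = begin
    heightsFrom (endHeightFrom h (s ∷ p)) (mirror (s ∷ p))
      ≡⟨ cong₂ heightsFrom (endHeightFrom-∷ h s p) (mirror-∷ s p) ⟩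
    heightsFrom e (mirror p ∷ʳ flip s)
      ≡⟨ heightsFrom-++ e (mirror p) (flip s ∷ []) ⟩
    initialHeights e (mirror p) ++ heightsFrom (endHeightFrom e (mirror p)) (flip s ∷ [])
      ≡⟨ cong (λ x → initialHeights e (mirror p) ++ heightsFrom x (flip s ∷ [])) back ⟩
    initialHeights e (mirror p) ++ heightsFrom h' (flip s ∷ [])
      ≡⟨ cong (initialHeights e (mirror p) ++_) (heightsFrom-∷ h' (flip s) []) ⟩
    initialHeights e (mirror p) ++ (h' ∷ move (flip s) h' ∷ [])
      ≡⟨ cong (λ x → initialHeights e (mirror p) ++ (h' ∷ x ∷ [])) (move-flip s h) ⟩
    initialHeights e (mirror p) ++ (h' ∷ h ∷ [])
      ≡⟨ LP.++-assoc (initialHeights e (mirror p)) (h' ∷ []) (h ∷ []) ⟨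
    (initialHeights e (mirror p) ∷ʳ h') ∷ʳ h
      ≡⟨ cong (λ x → (initialHeights e (mirror p) ∷ʳ x) ∷ʳ h) back ⟨
    (initialHeights e (mirror p) ∷ʳ endHeightFrom e (mirror p)) ∷ʳ h
      ≡⟨ cong (_∷ʳ h) (heightsFrom-split e (mirror p)) ⟨
    heightsFrom e (mirror p) ∷ʳ h
      ≡⟨ cong (_∷ʳ h) (heightsFrom-mirror h' p) ⟩
    reverse (heightsFrom h' p) ∷ʳ h
      ≡⟨ LP.unfold-reverse h (heightsFrom h' p) ⟨
    reverse (h ∷ heightsFrom h' p)
      ≡⟨ cong reverse (heightsFrom-∷ h s p) ⟨
    reverse (heightsFrom h (s ∷ p)) ∎
    where
    h' = move s h
    e  = endHeightFrom h' p
    back : endHeightFrom e (mirror p) ≡ h'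
    back = endHeightFrom-mirror h' p

  heightsFrom-head : ∀ c u → ∃ λ t → heightsFrom c u ≡ c ∷ t
  heightsFrom-head c []      = [] , refl
  heightsFrom-head c (U ∷ u) = _ , refl
  heightsFrom-head c (D ∷ u) = _ , refl

  heightsFrom-nonempty : ∀ c u → [] ≢ heightsFrom c u
  heightsFrom-nonempty c u eq with heightsFrom-head c u
  ... | t , e with trans eq e
  ... | ()

  move-injective : ∀ s t h → move s h ≡ move t h → s ≡ t
  move-injective s t h e with trans (sym (increment s h)) (trans (cong (ℤ._- h) e) (increment t h))
  move-injective U U h e | _  = refl
  move-injective D D h e | _  = refl
  move-injective U D h e | ()
  move-injective D U h e | ()

  heightsFrom-injective : ∀ a b u v → heightsFrom a u ≡ heightsFrom b v → u ≡ v
  heightsFrom-injective a b []      []      eq = refl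
  heightsFrom-injective a b []      (t ∷ v) eq =
    ⊥-elim (heightsFrom-nonempty _ v (LP.∷-injectiveʳ (trans eq (heightsFrom-∷ b t v))))
  heightsFrom-injective a b (s ∷ u) []      eq =
    ⊥-elim (heightsFrom-nonempty _ u (LP.∷-injectiveʳ (trans (sym eq) (heightsFrom-∷ a s u))))
  heightsFrom-injective a b (s ∷ u) (t ∷ v) eq =
    cong₂ _∷_ (move-injective s t a (trans (starts tails) (cong (move t) (sym a≡b))))
              (heightsFrom-injective _ _ u v tails)
    where
    both  = trans (sym (heightsFrom-∷ a s u)) (trans eq (heightsFrom-∷ b t v))
    a≡b   = LP.∷-injectiveˡ both
    tails = LP.∷-injectiveʳ both
    starts : ∀ {c d u v} → heightsFrom c u ≡ heightsFrom d v → c ≡ d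
    starts {c} {d} {u} {v} e with heightsFrom-head c u | heightsFrom-head d v
    ... | (x , ex) | (y , ey) = LP.∷-injectiveˡ (trans (sym ex) (trans e ey))

module ListSums where
  open import Data.Nat using (ℕ; _+_; _*_)
  import Data.Nat.Properties as ℕP
  open import Data.Nat.Tactic.RingSolver using (solve-∀)
  open import Data.Bool using (Bool; true; false)
  open import Data.List using (List; []; _∷_; _++_; map; reverse; length; filter)
  import Data.List.Properties as LP
  open import Data.Nat.ListAction using (sum)
  open import Relation.Nullary using (Dec; does)

  ι : Bool → ℕ
  ι true  = 1
  ι false = 0

  sumOver : {A : Set} → List A → (A → ℕ) → ℕ
  sumOver []       f = 0
  sumOver (x ∷ xs) f = f x + sumOver xs f

  module _ {A : Set} where

    sumOver-++ : ∀ (xs ys : List A) f → sumOver (xs ++ ys) f ≡ sumOver xs f + sumOver ys f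
    sumOver-++ []       ys f = refl
    sumOver-++ (x ∷ xs) ys f = trans (cong (f x +_) (sumOver-++ xs ys f)) (sym (ℕP.+-assoc (f x) _ _))

    sumOver-cong : ∀ (xs : List A) {f g} → (∀ x → f x ≡ g x) → sumOver xs f ≡ sumOver xs g
    sumOver-cong []       e = refl
    sumOver-cong (x ∷ xs) e = cong₂ _+_ (e x) (sumOver-cong xs e)

    sumOver-+ : ∀ (xs : List A) f g → sumOver xs (λ x → f x + g x) ≡ sumOver xs f + sumOver xs g
    sumOver-+ []       f g = refl
    sumOver-+ (x ∷ xs) f g = trans (cong (f x + g x +_) (sumOver-+ xs f g)) (interchange (f x) (g x) _ _)
      where
      interchange : ∀ a b c d → (a + b) + (c + d) ≡ (a + c) + (b + d)
      interchange = solve-∀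

    sumOver-* : ∀ (xs : List A) c f → sumOver xs (λ x → c * f x) ≡ c * sumOver xs f
    sumOver-* []       c f = sym (ℕP.*-zeroʳ c)
    sumOver-* (x ∷ xs) c f = trans (cong (c * f x +_) (sumOver-* xs c f)) (sym (ℕP.*-distribˡ-+ c (f x) _))

    sumOver-zero : ∀ (xs : List A) f → (∀ x → f x ≡ 0) → sumOver xs f ≡ 0
    sumOver-zero []       f e = refl
    sumOver-zero (x ∷ xs) f e = cong₂ _+_ (e x) (sumOver-zero xs f e)

    sumOver-reverse : ∀ (xs : List A) f → sumOver (reverse xs) f ≡ sumOver xs f
    sumOver-reverse []       f = refl
    sumOver-reverse (x ∷ xs) f = begin
      sumOver (reverse (x ∷ xs)) f           ≡⟨ cong (λ ys → sumOver ys f) (LP.unfold-reverse x xs) ⟩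
      sumOver (reverse xs ++ x ∷ []) f       ≡⟨ sumOver-++ (reverse xs) (x ∷ []) f ⟩
      sumOver (reverse xs) f + (f x + 0)     ≡⟨ cong₂ _+_ (sumOver-reverse xs f) (ℕP.+-identityʳ (f x)) ⟩
      sumOver xs f + f x                     ≡⟨ ℕP.+-comm _ (f x) ⟩
      sumOver (x ∷ xs) f                     ∎
      where open ≡-Reasoning

    sum-filter : ∀ {P : A → Set} (P? : ∀ x → Dec (P x)) (f : A → ℕ) xs →
      sum (map f (filter P? xs)) ≡ sumOver xs (λ x → ι (does (P? x)) * f x)
    sum-filter P? f [] = refl
    sum-filter P? f (x ∷ xs) with does (P? x)
    ... | true  = cong₂ _+_ (sym (ℕP.+-identityʳ (f x))) (sum-filter P? f xs)
    ... | false = sum-filter P? f xs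

    length-filter : ∀ {P : A → Set} (P? : ∀ x → Dec (P x)) xs →
      length (filter P? xs) ≡ sumOver xs (λ x → ι (does (P? x)))
    length-filter P? [] = refl
    length-filter P? (x ∷ xs) with does (P? x)
    ... | true  = cong (1 +_) (length-filter P? xs)
    ... | false = length-filter P? xs

  sumOver-map : ∀ {A B : Set} (g : A → B) xs f → sumOver (map g xs) f ≡ sumOver xs (f ∘ g)
  sumOver-map g []       f = refl
  sumOver-map g (x ∷ xs) f = cong (f (g x) +_) (sumOver-map g xs f)

module SymmetricPaths where
  open PathGeometry
  open ListSums
  open import Data.Nat using (_*_)
  import Data.Nat.Properties as ℕP
  open import Data.Integer as ℤ using (ℤ; 0ℤ)
  open import Data.Bool using (Bool; true; false)
  open import Data.List using (List; []; _∷_; _++_; reverse; length)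
  import Data.List.Properties as LP
  open import Data.List.Relation.Unary.All using (All; []; _∷_; all?)
  import Data.List.Relation.Unary.All.Properties as AllP
  open import Data.List.Relation.Binary.Permutation.Propositional using (↭-sym)
  open import Data.List.Relation.Binary.Permutation.Propositional.Properties using (All-resp-↭; ↭-reverse)
  open import Data.Product using (_×_; _,_; proj₁)
  open import Data.Empty using (⊥-elim)
  open import Relation.Nullary using (Dec; yes; no; does; ¬_)
  open import Relation.Nullary.Decidable using (_×-dec_)
  open ≡-Reasoning

  _==_ : Path → Path → Bool
  []      == []      = true
  (U ∷ p) == (U ∷ q) = p == q
  (D ∷ p) == (D ∷ q) = p == q
  _       == _       = false

  ==-refl : ∀ p → (p == p) ≡ true
  ==-refl []      = refl
  ==-refl (U ∷ p) = ==-refl p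
  ==-refl (D ∷ p) = ==-refl p

  ==-sound : ∀ p q → (p == q) ≡ true → p ≡ q
  ==-sound []      []      e = refl
  ==-sound (U ∷ p) (U ∷ q) e = cong (U ∷_) (==-sound p q e)
  ==-sound (D ∷ p) (D ∷ q) e = cong (D ∷_) (==-sound p q e)
  ==-sound []      (U ∷ q) ()
  ==-sound []      (D ∷ q) ()
  ==-sound (U ∷ p) []      ()
  ==-sound (U ∷ p) (D ∷ q) ()
  ==-sound (D ∷ p) []      ()
  ==-sound (D ∷ p) (U ∷ q) ()

  NonNeg : ℤ → Path → Set
  NonNeg h p = All (0ℤ ℤ.≤_) (heightsFrom h p)

  nonNeg? : ∀ h p → Dec (NonNeg h p)
  nonNeg? h p = all? (0ℤ ℤ.≤?_) (heightsFrom h p)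

  symDyck? : ∀ w → Dec (IsDyck w × IsSymmetric w)
  symDyck? w = isDyck? w ×-dec isSymmetric? w

  heights-doubled : ∀ p → heights (p ++ mirror p) ≡ initialHeights 0ℤ p ++ reverse (heights p)
  heights-doubled p = trans (heightsFrom-++ 0ℤ p (mirror p)) (cong (initialHeights 0ℤ p ++_) (heightsFrom-mirror 0ℤ p))

  endHeight-doubled : ∀ p → endHeightFrom 0ℤ (p ++ mirror p) ≡ 0ℤ
  endHeight-doubled p = trans (endHeightFrom-++ 0ℤ p (mirror p)) (endHeightFrom-mirror 0ℤ p)

  doubled-symmetric : ∀ p → IsSymmetric (p ++ mirror p)
  doubled-symmetric p = begin
    heights w                                        ≡⟨ cong heights self-mirror ⟨
    heightsFrom 0ℤ (mirror w)                        ≡⟨ cong (λ h → heightsFrom h (mirror w)) (endHeight-doubled p) ⟨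
    heightsFrom (endHeightFrom 0ℤ w) (mirror w)      ≡⟨ heightsFrom-mirror 0ℤ w ⟩
    reverse (heights w)                              ∎
    where
    w = p ++ mirror p
    self-mirror : mirror w ≡ w
    self-mirror = trans (mirror-++ p (mirror p)) (cong (_++ mirror p) (mirror-involutive p))

  symmetric-halves : ∀ p q → length q ≡ length p → IsSymmetric (p ++ q) → q ≡ mirror p
  symmetric-halves p q len symm =
    cancel-prefix p (mirror q) (sym (trans (length-mirror q) len)) w≡mirror
    where
    cancel-prefix : ∀ {A : Set} (xs xs' : List A) {ys ys'} → length xs ≡ length xs' →
      xs ++ ys ≡ xs' ++ ys' → ys ≡ ys'
    cancel-prefix []       []        l e = e
    cancel-prefix (x ∷ xs) (x' ∷ xs') l e = cancel-prefix xs xs' (ℕP.suc-injective l) (LP.∷-injectiveʳ e)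
    w = p ++ q
    w≡mirror : p ++ q ≡ mirror q ++ mirror p
    w≡mirror = trans (heightsFrom-injective 0ℤ (endHeightFrom 0ℤ w) w (mirror w)
                        (trans symm (sym (heightsFrom-mirror 0ℤ w))))
                     (mirror-++ p q)

  doubled-dyck⇒ : ∀ p → IsDyck (p ++ mirror p) → NonNeg 0ℤ p
  doubled-dyck⇒ p (above , _) =
    All-resp-↭ (↭-reverse (heights p)) (AllP.++⁻ʳ (initialHeights 0ℤ p) (subst (All _) (heights-doubled p) above))

  doubled-dyck⇐ : ∀ p → NonNeg 0ℤ p → IsDyck (p ++ mirror p)
  doubled-dyck⇐ p above =
    subst (All _) (sym (heights-doubled p)) (AllP.++⁺ initial (All-resp-↭ (↭-sym (↭-reverse (heights p))) above)) , endHeight-doubled p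
    where
    initial : All (0ℤ ℤ.≤_) (initialHeights 0ℤ p)
    initial = AllP.++⁻ˡ (initialHeights 0ℤ p) (subst (All _) (heightsFrom-split 0ℤ p) above)

  symDyck-indicator : ∀ p q → length q ≡ length p →
    ι (does (symDyck? (p ++ q))) ≡ ι (q == mirror p) * ι (does (nonNeg? 0ℤ p))
  symDyck-indicator p q len with q == mirror p in eq
  ... | true rewrite ==-sound q (mirror p) eq =
    trans (cong ι (sameDecision (symDyck? (p ++ mirror p)) (nonNeg? 0ℤ p)
                     (doubled-dyck⇒ p ∘ proj₁) (λ nn → doubled-dyck⇐ p nn , doubled-symmetric p)))
          (sym (ℕP.+-identityʳ _))
    where
    sameDecision : ∀ {A B : Set} (a? : Dec A) (b? : Dec B) → (A → B) → (B → A) → does a? ≡ does b?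
    sameDecision (yes a) (yes b) f g = refl
    sameDecision (no ¬a) (no ¬b) f g = refl
    sameDecision (yes a) (no ¬b) f g = ⊥-elim (¬b (f a))
    sameDecision (no ¬a) (yes b) f g = ⊥-elim (¬a (g b))
  ... | false = rejected (symDyck? (p ++ q)) λ (_ , symm) → true≢false (begin
      true               ≡⟨ ==-refl (mirror p) ⟨
      mirror p == mirror p ≡⟨ cong (_== mirror p) (symmetric-halves p q len symm) ⟨
      q == mirror p      ≡⟨ eq ⟩
      false              ∎)
    where
    true≢false : true ≢ false
    true≢false ()
    rejected : ∀ {A : Set} (a? : Dec A) → ¬ A → ι (does a?) ≡ 0
    rejected (yes a) ¬a = ⊥-elim (¬a a)
    rejected (no _)  ¬a = refl

module HalfPathCounts where
  open PathGeometry
  open ListSums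
  open SymmetricPaths
  open import Data.Nat using (ℕ; zero; suc; _+_; _*_)
  import Data.Nat.Properties as ℕP
  open import Data.Nat.Tactic.RingSolver using (solve-∀)
  open import Data.Integer as ℤ using (ℤ; 0ℤ)
  open import Data.List using (List; []; _∷_; _++_; map; reverse; length)
  open import Relation.Nullary using (does)
  open ≡-Reasoning

  sumOver-allPaths-suc : ∀ n F → sumOver (allPaths (suc n)) F
    ≡ sumOver (allPaths n) (λ p → F (U ∷ p)) + sumOver (allPaths n) (λ p → F (D ∷ p))
  sumOver-allPaths-suc n F =
    trans (sumOver-++ (map (U ∷_) (allPaths n)) (map (D ∷_) (allPaths n)) F)
          (cong₂ _+_ (sumOver-map (U ∷_) (allPaths n) F) (sumOver-map (D ∷_) (allPaths n) F))

  sumOver-allPaths-+ : ∀ a b F → sumOver (allPaths (a + b)) F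
    ≡ sumOver (allPaths a) (λ p → sumOver (allPaths b) (λ q → F (p ++ q)))
  sumOver-allPaths-+ zero    b F = sym (ℕP.+-identityʳ _)
  sumOver-allPaths-+ (suc a) b F = begin
    sumOver (allPaths (suc a + b)) F
      ≡⟨ sumOver-allPaths-suc (a + b) F ⟩
    sumOver (allPaths (a + b)) (λ w → F (U ∷ w)) + sumOver (allPaths (a + b)) (λ w → F (D ∷ w))
      ≡⟨ cong₂ _+_ (sumOver-allPaths-+ a b (λ w → F (U ∷ w))) (sumOver-allPaths-+ a b (λ w → F (D ∷ w))) ⟩
    sumOver (allPaths a) (λ p → G (U ∷ p)) + sumOver (allPaths a) (λ p → G (D ∷ p))
      ≡⟨ sumOver-allPaths-suc a G ⟨
    sumOver (allPaths (suc a)) G ∎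
    where G = λ p → sumOver (allPaths b) (λ q → F (p ++ q))

  sumOver-allPaths-cong : ∀ n {f g} → (∀ q → length q ≡ n → f q ≡ g q) →
    sumOver (allPaths n) f ≡ sumOver (allPaths n) g
  sumOver-allPaths-cong zero    e = cong (_+ 0) (e [] refl)
  sumOver-allPaths-cong (suc n) {f} {g} e = begin
    sumOver (allPaths (suc n)) f
      ≡⟨ sumOver-allPaths-suc n f ⟩
    sumOver (allPaths n) (λ q → f (U ∷ q)) + sumOver (allPaths n) (λ q → f (D ∷ q))
      ≡⟨ cong₂ _+_ (sumOver-allPaths-cong n (λ q l → e (U ∷ q) (cong suc l)))
                   (sumOver-allPaths-cong n (λ q l → e (D ∷ q) (cong suc l))) ⟩
    sumOver (allPaths n) (λ q → g (U ∷ q)) + sumOver (allPaths n) (λ q → g (D ∷ q))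
      ≡⟨ sumOver-allPaths-suc n g ⟨
    sumOver (allPaths (suc n)) g ∎

  sumOver-allPaths-select : ∀ n r → length r ≡ n → ∀ G →
    sumOver (allPaths n) (λ q → ι (q == r) * G q) ≡ G r
  sumOver-allPaths-select zero    []      l G = trans (ℕP.+-identityʳ _) (ℕP.+-identityʳ _)
  sumOver-allPaths-select (suc n) (U ∷ r) l G = trans (sumOver-allPaths-suc n _) (trans
    (cong₂ _+_ (sumOver-allPaths-select n r (ℕP.suc-injective l) (λ q → G (U ∷ q)))
               (sumOver-zero (allPaths n) _ (λ q → refl)))
    (ℕP.+-identityʳ _))
  sumOver-allPaths-select (suc n) (D ∷ r) l G = trans (sumOver-allPaths-suc n _)
    (cong₂ _+_ (sumOver-zero (allPaths n) _ (λ q → refl))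
               (sumOver-allPaths-select n r (ℕP.suc-injective l) (λ q → G (D ∷ q))))

  sum-symDyck : ∀ n (W : Path → ℕ) →
    sumOver (allPaths (n + n)) (λ w → ι (does (symDyck? w)) * W w)
      ≡ sumOver (allPaths n) (λ p → ι (does (nonNeg? 0ℤ p)) * W (p ++ mirror p))
  sum-symDyck n W =
    trans (sumOver-allPaths-+ n n (λ w → ι (does (symDyck? w)) * W w)) (sumOver-allPaths-cong n firstHalf)
    where
    firstHalf : ∀ p → length p ≡ n →
      sumOver (allPaths n) (λ q → ι (does (symDyck? (p ++ q))) * W (p ++ q))
        ≡ ι (does (nonNeg? 0ℤ p)) * W (p ++ mirror p)
    firstHalf p lp = trans (sumOver-allPaths-cong n secondHalf)
      (sumOver-allPaths-select n (mirror p) (trans (length-mirror p) lp) (λ q → ι (does (nonNeg? 0ℤ p)) * W (p ++ q)))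
      where
      secondHalf : ∀ q → length q ≡ n → ι (does (symDyck? (p ++ q))) * W (p ++ q)
        ≡ ι (q == mirror p) * (ι (does (nonNeg? 0ℤ p)) * W (p ++ q))
      secondHalf q lq = trans (cong (_* W (p ++ q)) (symDyck-indicator p q (trans lq (sym lp))))
                              (ℕP.*-assoc (ι (q == mirror p)) (ι (does (nonNeg? 0ℤ p))) (W (p ++ q)))

  zeros : List ℤ → ℕ
  zeros xs = sumOver xs (λ x → ι (does (x ℤ.≟ 0ℤ)))

  axisPoints-doubled : ∀ p → axisPoints (p ++ mirror p)
    ≡ zeros (initialHeights 0ℤ p) + (zeros (initialHeights 0ℤ p) + (ι (does (endHeightFrom 0ℤ p ℤ.≟ 0ℤ)) + 0))
  axisPoints-doubled p = begin
    axisPoints (p ++ mirror p)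
      ≡⟨ length-filter (ℤ._≟ 0ℤ) (heights (p ++ mirror p)) ⟩
    zeros (heights (p ++ mirror p))
      ≡⟨ cong zeros (heights-doubled p) ⟩
    zeros (initialHeights 0ℤ p ++ reverse (heights p))
      ≡⟨ sumOver-++ (initialHeights 0ℤ p) _ _ ⟩
    zeros (initialHeights 0ℤ p) + zeros (reverse (heights p))
      ≡⟨ cong (zeros (initialHeights 0ℤ p) +_) (sumOver-reverse (heights p) _) ⟩
    zeros (initialHeights 0ℤ p) + zeros (heights p)
      ≡⟨ cong (λ hs → zeros (initialHeights 0ℤ p) + zeros hs) (heightsFrom-split 0ℤ p) ⟩
    zeros (initialHeights 0ℤ p) + zeros (initialHeights 0ℤ p ++ endHeightFrom 0ℤ p ∷ [])
      ≡⟨ cong (zeros (initialHeights 0ℤ p) +_) (sumOver-++ (initialHeights 0ℤ p) _ _) ⟩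
    zeros (initialHeights 0ℤ p) + (zeros (initialHeights 0ℤ p) + (ι (does (endHeightFrom 0ℤ p ℤ.≟ 0ℤ)) + 0)) ∎

  nonNegCount returnCount visitCount : ℕ → ℤ → ℕ
  nonNegCount n h = sumOver (allPaths n) (λ p → ι (does (nonNeg? h p)))
  returnCount n h = sumOver (allPaths n) (λ p → ι (does (nonNeg? h p)) * ι (does (endHeightFrom h p ℤ.≟ 0ℤ)))
  visitCount  n h = sumOver (allPaths n) (λ p → ι (does (nonNeg? h p)) * zeros (initialHeights h p))

  2*n≡n+n : ∀ n → 2 * n ≡ n + n
  2*n≡n+n n = cong (n +_) (ℕP.+-identityʳ n)

  T-as-halves : ∀ n → T n ≡ 2 * visitCount n 0ℤ + returnCount n 0ℤ
  T-as-halves n = begin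
    T n
      ≡⟨ sum-filter symDyck? axisPoints (allPaths (2 * n)) ⟩
    sumOver (allPaths (2 * n)) (λ w → ι (does (symDyck? w)) * axisPoints w)
      ≡⟨ cong (λ k → sumOver (allPaths k) (λ w → ι (does (symDyck? w)) * axisPoints w)) (2*n≡n+n n) ⟩
    sumOver (allPaths (n + n)) (λ w → ι (does (symDyck? w)) * axisPoints w)
      ≡⟨ sum-symDyck n axisPoints ⟩
    sumOver (allPaths n) (λ p → ι (does (nonNeg? 0ℤ p)) * axisPoints (p ++ mirror p))
      ≡⟨ sumOver-cong (allPaths n) (λ p → trans (cong (ι (does (nonNeg? 0ℤ p)) *_) (axisPoints-doubled p))
                                               (expand (ι (does (nonNeg? 0ℤ p))) _ _)) ⟩
    sumOver (allPaths n) (λ p → 2 * (ι (does (nonNeg? 0ℤ p)) * zeros (initialHeights 0ℤ p))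
                              + ι (does (nonNeg? 0ℤ p)) * ι (does (endHeightFrom 0ℤ p ℤ.≟ 0ℤ)))
      ≡⟨ sumOver-+ (allPaths n) _ _ ⟩
    sumOver (allPaths n) (λ p → 2 * (ι (does (nonNeg? 0ℤ p)) * zeros (initialHeights 0ℤ p))) + returnCount n 0ℤ
      ≡⟨ cong (_+ returnCount n 0ℤ) (sumOver-* (allPaths n) 2 _) ⟩
    2 * visitCount n 0ℤ + returnCount n 0ℤ ∎
    where
    expand : ∀ i z e → i * (z + (z + (e + 0))) ≡ 2 * (i * z) + i * e
    expand = solve-∀

  symCount-as-halves : ∀ n → symCount n ≡ nonNegCount n 0ℤ
  symCount-as-halves n = begin
    symCount n
      ≡⟨ length-filter symDyck? (allPaths (2 * n)) ⟩
    sumOver (allPaths (2 * n)) (λ w → ι (does (symDyck? w)))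
      ≡⟨ sumOver-cong (allPaths (2 * n)) (λ w → sym (ℕP.*-identityʳ (ι (does (symDyck? w))))) ⟩
    sumOver (allPaths (2 * n)) (λ w → ι (does (symDyck? w)) * 1)
      ≡⟨ cong (λ k → sumOver (allPaths k) (λ w → ι (does (symDyck? w)) * 1)) (2*n≡n+n n) ⟩
    sumOver (allPaths (n + n)) (λ w → ι (does (symDyck? w)) * 1)
      ≡⟨ sum-symDyck n (λ _ → 1) ⟩
    sumOver (allPaths n) (λ p → ι (does (nonNeg? 0ℤ p)) * 1)
      ≡⟨ sumOver-cong (allPaths n) (λ p → ℕP.*-identityʳ (ι (does (nonNeg? 0ℤ p)))) ⟩
    nonNegCount n 0ℤ ∎

-- The counts of nonnegative paths from a height k ≥ 0 obey step recursions
-- (the first step goes up, or down if k > 0); we take the recursions as the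
-- definitions of the path numbers and identify them with the counts.
module PathNumbers where
  open PathGeometry
  open ListSums
  open SymmetricPaths
  open HalfPathCounts
  open import Data.Nat using (ℕ; zero; suc; _+_; _*_)
  import Data.Nat.Properties as ℕP
  open import Data.Integer as ℤ using (+_; -[1+_]; 0ℤ)
  open import Data.List using ([]; _∷_)
  open import Relation.Nullary using (does)
  open import Data.Bool using (false)
  open ≡-Reasoning

  -- paths⁺ n k: nonnegative paths of length n from height k
  paths⁺ : ℕ → ℕ → ℕ
  paths⁺ zero    k       = 1
  paths⁺ (suc n) zero    = paths⁺ n 1
  paths⁺ (suc n) (suc k) = paths⁺ n (suc (suc k)) + paths⁺ n k

  -- returns n k: those of them ending on the axis
  returns : ℕ → ℕ → ℕ
  returns zero    zero    = 1
  returns zero    (suc k) = 0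
  returns (suc n) zero    = returns n 1
  returns (suc n) (suc k) = returns n (suc (suc k)) + returns n k

  -- visits n k: their total number of axis points other than the endpoint
  visits : ℕ → ℕ → ℕ
  visits zero    k       = 0
  visits (suc n) zero    = paths⁺ n 1 + visits n 1
  visits (suc n) (suc k) = visits n (suc (suc k)) + visits n k

  below-axis : ∀ k p → does (nonNeg? -[1+ k ] p) ≡ false
  below-axis k []      = refl
  below-axis k (U ∷ p) = refl
  below-axis k (D ∷ p) = refl

  private
    up : ∀ k → + suc k ℤ.+ + 1 ≡ + suc (suc k)
    up k = cong (+_ ∘ suc) (ℕP.+-comm k 1)

  nonNegCount≡paths⁺ : ∀ n k → nonNegCount n (+ k) ≡ paths⁺ n k
  nonNegCount≡paths⁺ zero    k       = refl
  nonNegCount≡paths⁺ (suc n) zero    = trans (sumOver-allPaths-suc n _)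
    (trans (cong₂ _+_ (nonNegCount≡paths⁺ n 1) (sumOver-zero (allPaths n) _ (λ p → cong ι (below-axis 0 p))))
           (ℕP.+-identityʳ _))
  nonNegCount≡paths⁺ (suc n) (suc k) = trans (sumOver-allPaths-suc n _)
    (cong₂ _+_ (trans (cong (nonNegCount n) (up k)) (nonNegCount≡paths⁺ n (suc (suc k))))
               (nonNegCount≡paths⁺ n k))

  returnCount≡returns : ∀ n k → returnCount n (+ k) ≡ returns n k
  returnCount≡returns zero    zero    = refl
  returnCount≡returns zero    (suc k) = refl
  returnCount≡returns (suc n) zero    = trans (sumOver-allPaths-suc n _)
    (trans (cong₂ _+_ (returnCount≡returns n 1)
                      (sumOver-zero (allPaths n) _
                         (λ p → cong (λ b → ι b * ι (does (endHeightFrom -[1+ 0 ] p ℤ.≟ 0ℤ))) (below-axis 0 p))))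
           (ℕP.+-identityʳ _))
  returnCount≡returns (suc n) (suc k) = trans (sumOver-allPaths-suc n _)
    (cong₂ _+_ (trans (cong (returnCount n) (up k)) (returnCount≡returns n (suc (suc k))))
               (returnCount≡returns n k))

  visitCount≡visits : ∀ n k → visitCount n (+ k) ≡ visits n k
  visitCount≡visits zero    k       = refl
  visitCount≡visits (suc n) zero    = trans (sumOver-allPaths-suc n _)
    (trans (cong₂ _+_ fromAxis (sumOver-zero (allPaths n) _
                                  (λ p → cong (λ b → ι b * (1 + zeros (initialHeights -[1+ 0 ] p))) (below-axis 0 p))))
           (ℕP.+-identityʳ _))
    where
    -- the starting point is itself a visit
    fromAxis : sumOver (allPaths n) (λ p → ι (does (nonNeg? (+ 1) p)) * (1 + zeros (initialHeights (+ 1) p)))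
               ≡ paths⁺ n 1 + visits n 1
    fromAxis = begin
      sumOver (allPaths n) (λ p → ι (does (nonNeg? (+ 1) p)) * (1 + zeros (initialHeights (+ 1) p)))
        ≡⟨ sumOver-cong (allPaths n) (λ p → trans (ℕP.*-distribˡ-+ (ι (does (nonNeg? (+ 1) p))) 1 _)
                                          (cong (_+ ι (does (nonNeg? (+ 1) p)) * zeros (initialHeights (+ 1) p))
                                                (ℕP.*-identityʳ (ι (does (nonNeg? (+ 1) p)))))) ⟩
      sumOver (allPaths n) (λ p → ι (does (nonNeg? (+ 1) p)) + ι (does (nonNeg? (+ 1) p)) * zeros (initialHeights (+ 1) p))
        ≡⟨ sumOver-+ (allPaths n) _ _ ⟩
      nonNegCount n (+ 1) + visitCount n (+ 1)
        ≡⟨ cong₂ _+_ (nonNegCount≡paths⁺ n 1) (visitCount≡visits n 1) ⟩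
      paths⁺ n 1 + visits n 1 ∎
  visitCount≡visits (suc n) (suc k) = trans (sumOver-allPaths-suc n _)
    (cong₂ _+_ (trans (cong (visitCount n) (up k)) (visitCount≡visits n (suc (suc k))))
               (visitCount≡visits n k))

  T≡visits+returns : ∀ n → T n ≡ 2 * visits n 0 + returns n 0
  T≡visits+returns n =
    trans (T-as-halves n) (cong₂ (λ v r → 2 * v + r) (visitCount≡visits n 0) (returnCount≡returns n 0))

  symCount≡paths⁺ : ∀ n → symCount n ≡ paths⁺ n 0
  symCount≡paths⁺ n = trans (symCount-as-halves n) (nonNegCount≡paths⁺ n 0)

module RangeSums where
  open import Data.Nat using (ℕ; zero; suc; _+_; _*_; _∸_; _<_; s≤s; z≤n)
  import Data.Nat.Properties as ℕP
  open import Data.Nat.Tactic.RingSolver using (solve-∀)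
  open ≡-Reasoning

  sumℕ : ℕ → (ℕ → ℕ) → ℕ
  sumℕ zero    f = 0
  sumℕ (suc n) f = f 0 + sumℕ n (λ i → f (suc i))

  sumℕ-cong : ∀ n {f g} → (∀ i → i < n → f i ≡ g i) → sumℕ n f ≡ sumℕ n g
  sumℕ-cong zero    e = refl
  sumℕ-cong (suc n) e = cong₂ _+_ (e 0 (s≤s z≤n)) (sumℕ-cong n (λ i lt → e (suc i) (s≤s lt)))

  sumℕ-+ : ∀ n f g → sumℕ n (λ i → f i + g i) ≡ sumℕ n f + sumℕ n g
  sumℕ-+ zero    f g = refl
  sumℕ-+ (suc n) f g = trans (cong (f 0 + g 0 +_) (sumℕ-+ n (f ∘ suc) (g ∘ suc))) (interchange (f 0) (g 0) _ _)
    where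
    interchange : ∀ a b c d → (a + b) + (c + d) ≡ (a + c) + (b + d)
    interchange = solve-∀

  sumℕ-* : ∀ n c f → sumℕ n (λ i → c * f i) ≡ c * sumℕ n f
  sumℕ-* zero    c f = sym (ℕP.*-zeroʳ c)
  sumℕ-* (suc n) c f = trans (cong (c * f 0 +_) (sumℕ-* n c (f ∘ suc))) (sym (ℕP.*-distribˡ-+ c (f 0) _))

  sumℕ-last : ∀ n f → sumℕ (suc n) f ≡ sumℕ n f + f n
  sumℕ-last zero    f = ℕP.+-comm (f 0) 0
  sumℕ-last (suc n) f = trans (cong (f 0 +_) (sumℕ-last n (f ∘ suc))) (sym (ℕP.+-assoc (f 0) _ _))

  sumℕ-reverse : ∀ n f → sumℕ n f ≡ sumℕ n (λ i → f (n ∸ suc i))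
  sumℕ-reverse zero    f = refl
  sumℕ-reverse (suc n) f = begin
    f 0 + sumℕ n (f ∘ suc)
      ≡⟨ cong (f 0 +_) (sumℕ-reverse n (f ∘ suc)) ⟩
    f 0 + sumℕ n (λ i → f (suc (n ∸ suc i)))
      ≡⟨ cong (f 0 +_) (sumℕ-cong n (λ i lt → cong f (sym (ℕP.+-∸-assoc 1 lt)))) ⟩
    f 0 + sumℕ n (λ i → f (n ∸ i))
      ≡⟨ ℕP.+-comm (f 0) _ ⟩
    sumℕ n (λ i → f (n ∸ i)) + f 0
      ≡⟨ cong (λ z → sumℕ n (λ i → f (n ∸ i)) + f z) (ℕP.n∸n≡0 n) ⟨
    sumℕ n (λ i → f (n ∸ i)) + f (n ∸ n)
      ≡⟨ sumℕ-last n (λ i → f (suc n ∸ suc i)) ⟨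
    sumℕ (suc n) (λ i → f (suc n ∸ suc i)) ∎

module BinomialFacts where
  open import Data.Nat using (ℕ; zero; suc; _+_; _*_; _∸_; _≤_; s≤s; z≤n)
  import Data.Nat.Properties as ℕP
  open import Data.Nat.Combinatorics using (_C_; nCk+nC[k+1]≡[n+1]C[k+1]; k>n⇒nCk≡0; nC1≡n; nCk≡nC[n∸k])
  open import Data.Nat.Tactic.RingSolver using (solve-∀)
  open ≡-Reasoning

  double-suc : ∀ m → 2 * suc m ≡ suc (suc (2 * m))
  double-suc = solve-∀

  pascal : ∀ n k → n C k + n C suc k ≡ suc n C suc k
  pascal = nCk+nC[k+1]≡[n+1]C[k+1]

  middle-symmetry : ∀ m → suc (2 * m) C m ≡ suc (2 * m) C suc m
  middle-symmetry m = trans (nCk≡nC[n∸k] m≤) (cong (suc (2 * m) C_) complement)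
    where
    split : ∀ m → suc (2 * m) ≡ m + suc m
    split = solve-∀
    m≤ : m ≤ suc (2 * m)
    m≤ = subst (m ≤_) (sym (split m)) (ℕP.m≤m+n m (suc m))
    complement : suc (2 * m) ∸ m ≡ suc m
    complement = trans (cong (_∸ m) (split m)) (ℕP.m+n∸m≡n m (suc m))

  absorption : ∀ n k → suc k * (suc n C suc k) ≡ suc n * (n C k)
  absorption zero    zero    = refl
  absorption zero    (suc k) = begin
    suc (suc k) * (1 C suc (suc k))  ≡⟨ cong (suc (suc k) *_) (k>n⇒nCk≡0 {n = 1} {k = suc (suc k)} (s≤s (s≤s z≤n))) ⟩
    suc (suc k) * 0                  ≡⟨ ℕP.*-zeroʳ (suc (suc k)) ⟩
    0                                ≡⟨ cong (1 *_) (k>n⇒nCk≡0 {n = 0} {k = suc k} (s≤s z≤n)) ⟨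
    1 * (0 C suc k)                  ∎
  absorption (suc n) zero    = trans (ℕP.*-identityˡ _) (trans (nC1≡n (suc (suc n))) (sym (ℕP.*-identityʳ _)))
  absorption (suc n) (suc j) = begin
    suc (suc j) * (suc (suc n) C suc (suc j))
      ≡⟨ cong (suc (suc j) *_) (pascal (suc n) (suc j)) ⟨
    suc (suc j) * (x + y)
      ≡⟨ split j x y ⟩
    suc j * x + x + suc (suc j) * y
      ≡⟨ cong₂ (λ u v → u + x + v) (absorption n j) (absorption n (suc j)) ⟩
    suc n * (n C j) + x + suc n * (n C suc j)
      ≡⟨ regroup (suc n) (n C j) x (n C suc j) ⟩
    suc n * (n C j + n C suc j) + x
      ≡⟨ cong (λ z → suc n * z + x) (pascal n j) ⟩
    suc n * x + x
      ≡⟨ ℕP.+-comm (suc n * x) x ⟩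
    suc (suc n) * x ∎
    where
    x = suc n C suc j
    y = suc n C suc (suc j)
    split : ∀ j x y → suc (suc j) * (x + y) ≡ suc j * x + x + suc (suc j) * y
    split = solve-∀
    regroup : ∀ a p x q → a * p + x + a * q ≡ a * (p + q) + x
    regroup = solve-∀

  central : ℕ → ℕ
  central m = (2 * m) C m

  central-suc : ∀ m → central (suc m) ≡ 2 * (suc (2 * m) C suc m)
  central-suc m = begin
    (2 * suc m) C suc m                             ≡⟨ cong (_C suc m) (double-suc m) ⟩
    suc (suc (2 * m)) C suc m                       ≡⟨ pascal (suc (2 * m)) m ⟨
    suc (2 * m) C m + suc (2 * m) C suc m           ≡⟨ cong (_+ suc (2 * m) C suc m) (middle-symmetry m) ⟩
    suc (2 * m) C suc m + suc (2 * m) C suc m       ≡⟨ cong (suc (2 * m) C suc m +_) (ℕP.+-identityʳ _) ⟨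
    2 * (suc (2 * m) C suc m)                       ∎

  central-recurrence : ∀ m → suc m * central (suc m) ≡ 2 * suc (2 * m) * central m
  central-recurrence m = begin
    suc m * central (suc m)                  ≡⟨ cong (suc m *_) (central-suc m) ⟩
    suc m * (2 * (suc (2 * m) C suc m))      ≡⟨ swap (suc m) (suc (2 * m) C suc m) ⟩
    2 * (suc m * (suc (2 * m) C suc m))      ≡⟨ cong (2 *_) (absorption (2 * m) m) ⟩
    2 * (suc (2 * m) * central m)            ≡⟨ ℕP.*-assoc 2 (suc (2 * m)) (central m) ⟨
    2 * suc (2 * m) * central m              ∎
    where
    swap : ∀ a c → a * (2 * c) ≡ 2 * (a * c)
    swap = solve-∀

  central-suc-suc : ∀ m → central (suc (suc m)) ≡ 2 * ((2 * m + 2) C m) + 2 * central (suc m)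
  central-suc-suc m = begin
    central (suc (suc m))
      ≡⟨ central-suc (suc m) ⟩
    2 * (suc (2 * suc m) C suc (suc m))
      ≡⟨ cong (2 *_) (middle-symmetry (suc m)) ⟨
    2 * (suc (2 * suc m) C suc m)
      ≡⟨ cong (λ z → 2 * (suc z C suc m)) (double-suc m) ⟩
    2 * (suc (suc (suc (2 * m))) C suc m)
      ≡⟨ cong (2 *_) (pascal (suc (suc (2 * m))) m) ⟨
    2 * (suc (suc (2 * m)) C m + suc (suc (2 * m)) C suc m)
      ≡⟨ cong₂ (λ x y → 2 * (x C m + y C suc m)) (ℕP.+-comm 2 (2 * m)) (sym (double-suc m)) ⟩
    2 * ((2 * m + 2) C m + central (suc m))
      ≡⟨ ℕP.*-distribˡ-+ 2 ((2 * m + 2) C m) (central (suc m)) ⟩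
    2 * ((2 * m + 2) C m) + 2 * central (suc m) ∎

  shifted-absorption : ∀ m → suc (suc m) * ((2 * m + 2) C m) ≡ 2 * suc m * ((2 * m + 1) C m)
  shifted-absorption m = begin
    suc (suc m) * ((2 * m + 2) C m)
      ≡⟨ cong (suc (suc m) *_) mirrored ⟩
    suc (suc m) * (suc (suc (2 * m)) C suc (suc m))
      ≡⟨ absorption (suc (2 * m)) (suc m) ⟩
    suc (suc (2 * m)) * (suc (2 * m) C suc m)
      ≡⟨ cong₂ _*_ (sym (double-suc m)) (sym (trans (cong (_C m) (ℕP.+-comm (2 * m) 1)) (middle-symmetry m))) ⟩
    2 * suc m * ((2 * m + 1) C m) ∎
    where
    split : ∀ m → 2 * m + 2 ≡ m + suc (suc m)
    split = solve-∀
    mirrored : (2 * m + 2) C m ≡ suc (suc (2 * m)) C suc (suc m)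
    mirrored = trans (nCk≡nC[n∸k] (subst (m ≤_) (sym (split m)) (ℕP.m≤m+n m (suc (suc m)))))
                     (cong₂ _C_ (ℕP.+-comm (2 * m) 2)
                                (trans (cong (_∸ m) (split m)) (ℕP.m+n∸m≡n m (suc (suc m)))))

module PathNumberFormulas where
  open PathNumbers using (paths⁺; returns; visits)
  open RangeSums
  open BinomialFacts
  open import Data.Nat using (ℕ; zero; suc; _+_; _*_; _∸_; _<_; s≤s)
  import Data.Nat.Properties as ℕP
  open import Data.Nat.Combinatorics using (_C_; k>n⇒nCk≡0)
  open import Data.Nat.Tactic.RingSolver using (solve-∀)
  open import Data.Bool using (Bool; true; false)
  open import Data.Product using (∃; _,_)
  open ≡-Reasoning

  private
    interchange : ∀ a b c d → (a + b) + (c + d) ≡ (a + c) + (b + d)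
    interchange = solve-∀

  -- A nonnegative path extends by either step, except by a down step when it
  -- ends on the axis.
  paths⁺-extend : ∀ n k → paths⁺ (suc n) k + returns n k ≡ paths⁺ n k + paths⁺ n k
  paths⁺-extend zero    zero    = refl
  paths⁺-extend zero    (suc k) = refl
  paths⁺-extend (suc n) zero    = paths⁺-extend n 1
  paths⁺-extend (suc n) (suc k) = begin
    (paths⁺ (suc n) (suc (suc k)) + paths⁺ (suc n) k) + (returns n (suc (suc k)) + returns n k)
      ≡⟨ interchange (paths⁺ (suc n) (suc (suc k))) (paths⁺ (suc n) k) _ _ ⟩
    (paths⁺ (suc n) (suc (suc k)) + returns n (suc (suc k))) + (paths⁺ (suc n) k + returns n k)
      ≡⟨ cong₂ _+_ (paths⁺-extend n (suc (suc k))) (paths⁺-extend n k) ⟩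
    (paths⁺ n (suc (suc k)) + paths⁺ n (suc (suc k))) + (paths⁺ n k + paths⁺ n k)
      ≡⟨ interchange (paths⁺ n (suc (suc k))) (paths⁺ n (suc (suc k))) _ _ ⟩
    (paths⁺ n (suc (suc k)) + paths⁺ n k) + (paths⁺ n (suc (suc k)) + paths⁺ n k) ∎

  -- Cutting a path at an axis visit at time t leaves a path returning to the
  -- axis at time t followed by an arbitrary nonnegative path from the axis.
  visits-decomposition : ∀ n k → visits n k ≡ sumℕ n (λ t → returns t k * paths⁺ (n ∸ t) 0)
  visits-decomposition zero    k       = refl
  visits-decomposition (suc n) zero    = cong₂ _+_ (sym (ℕP.*-identityˡ (paths⁺ n 1))) (visits-decomposition n 1)
  visits-decomposition (suc n) (suc k) = begin
    visits n (suc (suc k)) + visits n k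
      ≡⟨ cong₂ _+_ (visits-decomposition n (suc (suc k))) (visits-decomposition n k) ⟩
    sumℕ n (λ t → returns t (suc (suc k)) * paths⁺ (n ∸ t) 0) + sumℕ n (λ t → returns t k * paths⁺ (n ∸ t) 0)
      ≡⟨ sumℕ-+ n _ _ ⟨
    sumℕ n (λ t → returns t (suc (suc k)) * paths⁺ (n ∸ t) 0 + returns t k * paths⁺ (n ∸ t) 0)
      ≡⟨ sumℕ-cong n (λ t _ → sym (ℕP.*-distribʳ-+ (paths⁺ (n ∸ t) 0) (returns t (suc (suc k))) (returns t k))) ⟩
    sumℕ n (λ t → returns (suc t) (suc k) * paths⁺ (n ∸ t) 0) ∎

  -- freeReturns n k: paths of length n from height k to the axis, allowed to
  -- go below it (counted through the symmetry k ↦ -k at the axis)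
  freeReturns : ℕ → ℕ → ℕ
  freeReturns zero    zero    = 1
  freeReturns zero    (suc k) = 0
  freeReturns (suc n) zero    = freeReturns n 1 + freeReturns n 1
  freeReturns (suc n) (suc k) = freeReturns n (suc (suc k)) + freeReturns n k

  -- reflection principle: the paths from k that touch height -1 correspond to
  -- the free paths from k + 2
  reflection : ∀ n k → returns n k + freeReturns n (suc (suc k)) ≡ freeReturns n k
  reflection zero    zero    = refl
  reflection zero    (suc k) = refl
  reflection (suc n) zero    =
    trans (sym (ℕP.+-assoc (returns n 1) (freeReturns n 3) (freeReturns n 1))) (cong (_+ freeReturns n 1) (reflection n 1))
  reflection (suc n) (suc k) = begin
    (returns n (suc (suc k)) + returns n k) + (freeReturns n (suc (suc (suc (suc k)))) + freeReturns n (suc (suc k)))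
      ≡⟨ interchange (returns n (suc (suc k))) (returns n k) _ _ ⟩
    (returns n (suc (suc k)) + freeReturns n (suc (suc (suc (suc k))))) + (returns n k + freeReturns n (suc (suc k)))
      ≡⟨ cong₂ _+_ (reflection n (suc (suc k))) (reflection n k) ⟩
    freeReturns n (suc (suc k)) + freeReturns n k ∎

  freeReturns-far : ∀ n k → n < k → freeReturns n k ≡ 0
  freeReturns-far zero    (suc k) _          = refl
  freeReturns-far (suc n) (suc k) (s≤s n<k) =
    cong₂ _+_ (freeReturns-far n (suc (suc k)) (ℕP.m<n⇒m<1+n (ℕP.m<n⇒m<1+n n<k))) (freeReturns-far n k n<k)

  -- from the axis both first steps lead to height 1, and an odd row is symmetric
  closed-from-axis : ∀ n b → n ≡ suc (2 * b) → freeReturns n 1 ≡ n C suc b →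
                     freeReturns (suc n) 0 ≡ suc n C suc b
  closed-from-axis n b refl ih = begin
    freeReturns n 1 + freeReturns n 1   ≡⟨ cong₂ _+_ (trans ih (sym (middle-symmetry b))) ih ⟩
    n C b + n C suc b                   ≡⟨ pascal n b ⟩
    suc n C suc b                       ∎

  -- with exactly as many steps as the height, only going straight down works
  closed-straight : ∀ n → freeReturns n n ≡ n C n → freeReturns (suc n) (suc n) ≡ suc n C suc n
  closed-straight n ih = begin
    freeReturns n (suc (suc n)) + freeReturns n n
      ≡⟨ cong₂ _+_ (freeReturns-far n (suc (suc n)) (ℕP.m<n⇒m<1+n (ℕP.n<1+n n))) ih ⟩
    n C n
      ≡⟨ ℕP.+-identityʳ (n C n) ⟨
    n C n + 0
      ≡⟨ cong (n C n +_) (k>n⇒nCk≡0 (ℕP.n<1+n n)) ⟨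
    n C n + n C suc n
      ≡⟨ pascal n n ⟩
    suc n C suc n ∎

  -- above the axis, a step up or down
  closed-pascal : ∀ n h d → freeReturns n (suc (suc h)) ≡ n C suc (suc d) → freeReturns n h ≡ n C suc d →
                  freeReturns (suc n) (suc h) ≡ suc n C suc (suc d)
  closed-pascal n h d up down =
    trans (cong₂ _+_ up down) (trans (ℕP.+-comm (n C suc (suc d)) (n C suc d)) (pascal n (suc d)))

  -- a free path from h returning in 2b + h steps takes b + h down steps
  freeReturns-closed : ∀ b h → freeReturns (b + b + h) h ≡ (b + b + h) C (b + h)
  freeReturns-closed b h = closed (b + b + h) b h refl
    where
    closed : ∀ n b h → n ≡ b + b + h → freeReturns n h ≡ n C (b + h)
    closed zero    zero    zero    e = refl
    closed (suc n) (suc b) zero    e =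
      trans (closed-from-axis n b (ℕP.suc-injective (trans e (odd b)))
                              (trans (closed n b 1 (ℕP.suc-injective (trans e (odd′ b)))) (cong (n C_) (ℕP.+-comm b 1))))
            (cong (suc n C_) (sym (ℕP.+-identityʳ (suc b))))
      where
      odd : ∀ b → suc b + suc b + 0 ≡ suc (suc (2 * b))
      odd = solve-∀
      odd′ : ∀ b → suc b + suc b + 0 ≡ suc (b + b + 1)
      odd′ = solve-∀
    closed (suc n) zero    (suc h) e with ℕP.suc-injective e
    ... | refl = closed-straight n (closed n 0 n refl)
    closed (suc n) (suc b) (suc h) e =
      trans (closed-pascal n h (b + h) (trans (closed n b (suc (suc h)) (ℕP.suc-injective (trans e (up b h))))
                                              (cong (n C_) (two-more b h)))
                                       (closed n (suc b) h (ℕP.suc-injective (trans e (down b h)))))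
            (cong (suc n C_) (sym (shifted b h)))
      where
      up : ∀ b h → suc b + suc b + suc h ≡ suc (b + b + suc (suc h))
      up = solve-∀
      down : ∀ b h → suc b + suc b + suc h ≡ suc (suc b + suc b + h)
      down = solve-∀
      two-more : ∀ b h → b + suc (suc h) ≡ suc (suc (b + h))
      two-more = solve-∀
      shifted : ∀ b h → suc b + suc h ≡ suc (suc (b + h))
      shifted = solve-∀

  even : ℕ → Bool
  even zero          = true
  even (suc zero)    = false
  even (suc (suc n)) = even n

  returns-parity : ∀ n k → even (n + k) ≡ false → returns n k ≡ 0
  returns-parity zero    zero    ()
  returns-parity zero    (suc k) e = refl
  returns-parity (suc n) zero    e =
    returns-parity n 1 (trans (cong even (trans (ℕP.+-comm n 1) (cong suc (sym (ℕP.+-identityʳ n))))) e)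
  returns-parity (suc n) (suc k) e = cong₂ _+_
    (returns-parity n (suc (suc k)) (trans (cong even (ℕP.+-suc n (suc k))) e))
    (returns-parity n k (trans (sym (cong (even ∘ suc) (ℕP.+-suc n k))) e))

  returns-odd : ∀ m → returns (suc (2 * m)) 0 ≡ 0
  returns-odd m = returns-parity (suc (2 * m)) 0 (odd m)
    where
    odd : ∀ m → even (suc (2 * m) + 0) ≡ false
    odd zero    = refl
    odd (suc m) = trans (cong (even ∘ suc) (shape m)) (odd m)
      where
      shape : ∀ m → 2 * suc m + 0 ≡ suc (suc (2 * m + 0))
      shape = solve-∀

  catalan : ∀ m → returns (2 * m) 0 + (2 * m) C suc m ≡ central m
  catalan zero    = refl
  catalan (suc b) = begin
    returns (2 * suc b) 0 + (2 * suc b) C suc (suc b)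
      ≡⟨ cong (returns (2 * suc b) 0 +_) from2 ⟨
    returns (2 * suc b) 0 + freeReturns (2 * suc b) 2
      ≡⟨ reflection (2 * suc b) 0 ⟩
    freeReturns (2 * suc b) 0
      ≡⟨ cong (λ z → freeReturns z 0) (shape₀ (suc b)) ⟩
    freeReturns (suc b + suc b + 0) 0
      ≡⟨ freeReturns-closed (suc b) 0 ⟩
    (suc b + suc b + 0) C (suc b + 0)
      ≡⟨ cong₂ _C_ (sym (shape₀ (suc b))) (ℕP.+-identityʳ (suc b)) ⟩
    central (suc b) ∎
    where
    shape₀ : ∀ b → 2 * b ≡ b + b + 0
    shape₀ = solve-∀
    shape₂ : ∀ b → 2 * suc b ≡ b + b + 2
    shape₂ = solve-∀
    from2 : freeReturns (2 * suc b) 2 ≡ (2 * suc b) C suc (suc b)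
    from2 = trans (cong (λ z → freeReturns z 2) (shape₂ b))
                  (trans (freeReturns-closed b 2) (cong₂ _C_ (sym (shape₂ b)) (ℕP.+-comm b 2)))

  paths⁺-even : ∀ m → paths⁺ (2 * m) 0 ≡ central m
  paths⁺-odd  : ∀ m → paths⁺ (suc (2 * m)) 0 ≡ suc (2 * m) C suc m

  paths⁺-even zero    = refl
  paths⁺-even (suc m) = begin
    paths⁺ (2 * suc m) 0
      ≡⟨ cong (λ z → paths⁺ z 0) (double-suc m) ⟩
    paths⁺ (suc (suc (2 * m))) 0
      ≡⟨ ℕP.+-identityʳ _ ⟨
    paths⁺ (suc (suc (2 * m))) 0 + 0
      ≡⟨ cong (paths⁺ (suc (suc (2 * m))) 0 +_) (returns-odd m) ⟨
    paths⁺ (suc (suc (2 * m))) 0 + returns (suc (2 * m)) 0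
      ≡⟨ paths⁺-extend (suc (2 * m)) 0 ⟩
    paths⁺ (suc (2 * m)) 0 + paths⁺ (suc (2 * m)) 0
      ≡⟨ cong₂ _+_ (trans (paths⁺-odd m) (sym (middle-symmetry m))) (paths⁺-odd m) ⟩
    suc (2 * m) C m + suc (2 * m) C suc m
      ≡⟨ pascal (suc (2 * m)) m ⟩
    suc (suc (2 * m)) C suc m
      ≡⟨ cong (_C suc m) (double-suc m) ⟨
    central (suc m) ∎
  paths⁺-odd m = ℕP.+-cancelʳ-≡ (central m) _ _ (begin
    paths⁺ (suc (2 * m)) 0 + central m
      ≡⟨ cong (paths⁺ (suc (2 * m)) 0 +_) (catalan m) ⟨
    paths⁺ (suc (2 * m)) 0 + (returns (2 * m) 0 + (2 * m) C suc m)
      ≡⟨ ℕP.+-assoc (paths⁺ (suc (2 * m)) 0) _ _ ⟨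
    paths⁺ (suc (2 * m)) 0 + returns (2 * m) 0 + (2 * m) C suc m
      ≡⟨ cong (_+ (2 * m) C suc m) (paths⁺-extend (2 * m) 0) ⟩
    paths⁺ (2 * m) 0 + paths⁺ (2 * m) 0 + (2 * m) C suc m
      ≡⟨ cong (λ z → z + z + (2 * m) C suc m) (paths⁺-even m) ⟩
    central m + central m + (2 * m) C suc m
      ≡⟨ regroup (central m) _ ⟩
    (central m + (2 * m) C suc m) + central m
      ≡⟨ cong (_+ central m) (pascal (2 * m) m) ⟩
    suc (2 * m) C suc m + central m ∎)
    where
    regroup : ∀ a c → a + a + c ≡ (a + c) + a
    regroup = solve-∀

  -- there is always at least one nonnegative path (the one going straight up)
  paths⁺-positive : ∀ n k → ∃ λ j → paths⁺ n k ≡ suc j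
  paths⁺-positive zero    k       = 0 , refl
  paths⁺-positive (suc n) zero    = paths⁺-positive n 1
  paths⁺-positive (suc n) (suc k) with paths⁺-positive n k
  ... | j , e = paths⁺ n (suc (suc k)) + j , trans (cong (paths⁺ n (suc (suc k)) +_) e) (ℕP.+-suc _ j)

module RationalArithmetic where
  open import Data.Nat as ℕ using (ℕ; suc; _≤_; s≤s)
  import Data.Nat.Properties as ℕP
  import Data.Nat.Coprimality as Coprime
  open import Data.Integer as ℤ using (+_; -[1+_]; +[1+_])
  import Data.Integer.Properties as ℤP
  open import Data.Rational as ℚ using (ℚ; mkℚ; 0ℚ; 1ℚ; _+_; _*_; -_; _/_; _<_; ∣_∣)
  import Data.Rational.Properties as ℚP
  import Data.Rational.Unnormalised as ℚᵘ
  import Data.Rational.Unnormalised.Properties as ℚᵘP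
  open import Data.Product using (∃; _,_)
  open import Data.Maybe using (Maybe; just; nothing)
  open import Relation.Nullary using (Dec; yes; no)
  open import Tactic.RingSolver.Core.AlmostCommutativeRing using (AlmostCommutativeRing; fromCommutativeRing)
  open ≡-Reasoning

  ℚ-ring : AlmostCommutativeRing _ _
  ℚ-ring = fromCommutativeRing ℚP.+-*-commutativeRing (λ x → isZero (0ℚ ℚP.≟ x))
    where
    isZero : ∀ {x} → Dec (0ℚ ≡ x) → Maybe (0ℚ ≡ x)
    isZero (yes p) = just p
    isZero (no _)  = nothing

  fromℕ-normal : ∀ n → fromℕ n ≡ mkℚ (+ n) 0 (Coprime.sym (Coprime.1-coprimeTo n))
  fromℕ-normal n = ℚP.normalize-coprime (Coprime.sym (Coprime.1-coprimeTo n))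

  fromℕ-+ : ∀ m n → fromℕ (m ℕ.+ n) ≡ fromℕ m + fromℕ n
  fromℕ-+ m n rewrite fromℕ-normal m | fromℕ-normal n =
    cong (_/ 1) (sym (cong₂ ℤ._+_ (ℤP.*-identityʳ (+ m)) (ℤP.*-identityʳ (+ n))))

  fromℕ-* : ∀ m n → fromℕ (m ℕ.* n) ≡ fromℕ m * fromℕ n
  fromℕ-* m n rewrite fromℕ-normal m | fromℕ-normal n = cong (_/ 1) (ℤP.pos-* m n)

  fromℕ-suc : ∀ n → fromℕ (suc n) ≡ fromℕ n + 1ℚ
  fromℕ-suc n = trans (cong fromℕ (ℕP.+-comm 1 n)) (fromℕ-+ n 1)

  fromℕ-*+ : ∀ a m c → fromℕ (a ℕ.* m ℕ.+ c) ≡ fromℕ a * fromℕ m + fromℕ c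
  fromℕ-*+ a m c = trans (fromℕ-+ (a ℕ.* m) c) (cong (_+ fromℕ c) (fromℕ-* a m))

  recip : ℕ → ℚ
  recip k = + 1 / suc k

  recip-normal : ∀ k → recip k ≡ mkℚ (+ 1) k (Coprime.1-coprimeTo (suc k))
  recip-normal k = ℚP.normalize-coprime (Coprime.1-coprimeTo (suc k))

  recip-inverse : ∀ k → fromℕ (suc k) * recip k ≡ 1ℚ
  recip-inverse k rewrite fromℕ-normal (suc k) | recip-normal k =
    ℚP.*-inverseʳ (mkℚ (+ suc k) 0 (Coprime.sym (Coprime.1-coprimeTo (suc k))))

  /-as-recip : ∀ n k → + n / suc k ≡ fromℕ n * recip k
  /-as-recip n k rewrite fromℕ-normal n | recip-normal k =
    ℚP./-cong (sym (ℤP.*-identityʳ (+ n))) (sym (ℕP.+-identityʳ (suc k)))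

  divℕ-unique : ∀ p k x → x * fromℕ (suc k) ≡ p → divℕ p (suc k) ≡ x
  divℕ-unique p k x e = begin
    p * recip k                        ≡⟨ cong (_* recip k) e ⟨
    x * fromℕ (suc k) * recip k        ≡⟨ ℚP.*-assoc x (fromℕ (suc k)) (recip k) ⟩
    x * (fromℕ (suc k) * recip k)      ≡⟨ cong (x *_) (recip-inverse k) ⟩
    x * 1ℚ                             ≡⟨ ℚP.*-identityʳ x ⟩
    x                                  ∎

  divℕ-unique′ : ∀ p d x {j} → d ≡ suc j → x * fromℕ d ≡ p → divℕ p d ≡ x
  divℕ-unique′ p d x {j} refl = divℕ-unique p j x

  ∣-fraction∣ : ∀ c k → ∣ - (+ c / suc k) ∣ ≡ + c / suc k
  ∣-fraction∣ c k = trans (ℚP.∣-p∣≡∣p∣ (+ c / suc k))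
    (ℚP.0≤p⇒∣p∣≡p (ℚP.nonNegative⁻¹ (+ c / suc k) {{ℚP.normalize-nonNeg c (suc k)}}))

  -- c / (M + 1) < ε for all M ≥ N: take N = c · d for ε = k / d in lowest terms
  fraction-vanishes : ∀ c (ε : ℚ) → 0ℚ < ε → ∃ λ N → ∀ M → N ≤ M → + c / suc M < ε
  fraction-vanishes c ε pos = vanish ε (subst (_< ε) (fromℕ-normal 0) pos)
    where
    vanish : ∀ ε → mkℚ (+ 0) 0 (Coprime.sym (Coprime.1-coprimeTo 0)) < ε →
             ∃ λ N → ∀ M → N ≤ M → + c / suc M < ε
    vanish (mkℚ +[1+ k ] d _) _ = c ℕ.* suc d , λ M N≤M →
      ℚP.toℚᵘ-cancel-< (ℚᵘP.<-respˡ-≃ (ℚᵘP.≃-sym (ℚP.toℚᵘ-fromℚᵘ (ℚᵘ.mkℚᵘ (+ c) M)))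
                                      (ℚᵘ.*<* (cross-multiplied M N≤M)))
      where
      cross-multiplied : ∀ M → c ℕ.* suc d ≤ M → + c ℤ.* + suc d ℤ.< + suc k ℤ.* + suc M
      cross-multiplied M N≤M = subst₂ ℤ._<_ (ℤP.pos-* c (suc d)) (ℤP.pos-* (suc k) (suc M))
        (ℤ.+<+ (ℕP.≤-trans (s≤s N≤M) (ℕP.m≤n*m (suc M) (suc k))))
    vanish (mkℚ (+ 0) d _) (ℚ.*<* (ℤ.+<+ ()))
    vanish (mkℚ -[1+ k ] d _) (ℚ.*<* ())

module SeriesAlgebra where
  open RationalArithmetic using (ℚ-ring; fromℕ-+)
  open RangeSums using (sumℕ)
  open import Data.Nat using (ℕ; zero; suc; _∸_; _<_)
  import Data.Nat.Properties as ℕP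
  open import Data.Rational using (ℚ; 0ℚ; 1ℚ; _+_; _*_; _-_; -_)
  import Data.Rational.Properties as ℚP
  open import Tactic.RingSolver using (solve-∀)
  open ≡-Reasoning

  sumTo-cong : ∀ n {f g : ℕ → ℚ} → (∀ i → i < n → f i ≡ g i) → sumTo n f ≡ sumTo n g
  sumTo-cong zero    e = refl
  sumTo-cong (suc n) e = cong₂ _+_ (sumTo-cong n (λ i i<n → e i (ℕP.m<n⇒m<1+n i<n))) (e n ℕP.≤-refl)

  sumTo-cong′ : ∀ n {f g : ℕ → ℚ} → (∀ i → f i ≡ g i) → sumTo n f ≡ sumTo n g
  sumTo-cong′ n e = sumTo-cong n (λ i _ → e i)

  sumTo-+ : ∀ n f g → sumTo n (λ i → f i + g i) ≡ sumTo n f + sumTo n g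
  sumTo-+ zero    f g = sym (ℚP.+-identityʳ 0ℚ)
  sumTo-+ (suc n) f g = trans (cong (_+ (f n + g n)) (sumTo-+ n f g)) (interchange (sumTo n f) (sumTo n g) (f n) (g n))
    where
    interchange : ∀ a b c d → (a + b) + (c + d) ≡ (a + c) + (b + d)
    interchange = solve-∀ ℚ-ring

  sumTo-* : ∀ n c f → sumTo n (λ i → c * f i) ≡ c * sumTo n f
  sumTo-* zero    c f = sym (ℚP.*-zeroʳ c)
  sumTo-* (suc n) c f = trans (cong (_+ c * f n) (sumTo-* n c f)) (sym (ℚP.*-distribˡ-+ c (sumTo n f) (f n)))

  sumTo-neg : ∀ n f → sumTo n (λ i → - f i) ≡ - sumTo n f
  sumTo-neg zero    f = refl
  sumTo-neg (suc n) f = trans (cong (_+ - f n) (sumTo-neg n f)) (sym (ℚP.neg-distrib-+ (sumTo n f) (f n)))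

  sumTo-- : ∀ n f g → sumTo n (λ i → f i - g i) ≡ sumTo n f - sumTo n g
  sumTo-- n f g = trans (sumTo-+ n f (λ i → - g i)) (cong (sumTo n f +_) (sumTo-neg n g))

  sumTo-zero : ∀ n {f} → (∀ i → i < n → f i ≡ 0ℚ) → sumTo n f ≡ 0ℚ
  sumTo-zero zero    e = refl
  sumTo-zero (suc n) e =
    trans (cong₂ _+_ (sumTo-zero n (λ i i<n → e i (ℕP.m<n⇒m<1+n i<n))) (e n ℕP.≤-refl)) (ℚP.+-identityʳ 0ℚ)

  sumTo-first : ∀ n f → sumTo (suc n) f ≡ f 0 + sumTo n (f ∘ suc)
  sumTo-first zero    f = trans (ℚP.+-identityˡ (f 0)) (sym (ℚP.+-identityʳ (f 0)))
  sumTo-first (suc n) f = trans (cong (_+ f (suc n)) (sumTo-first n f)) (ℚP.+-assoc (f 0) _ _)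

  sumTo-reverse : ∀ n f → sumTo n f ≡ sumTo n (λ i → f (n ∸ suc i))
  sumTo-reverse zero    f = refl
  sumTo-reverse (suc n) f = trans (cong (_+ f n) (sumTo-reverse n f))
    (trans (ℚP.+-comm _ (f n)) (sym (sumTo-first n (λ i → f (suc n ∸ suc i)))))

  fromℕ-sumℕ : ∀ n f → fromℕ (sumℕ n f) ≡ sumTo n (fromℕ ∘ f)
  fromℕ-sumℕ zero    f = refl
  fromℕ-sumℕ (suc n) f = trans (fromℕ-+ (f 0) (sumℕ n (f ∘ suc)))
    (trans (cong (fromℕ (f 0) +_) (fromℕ-sumℕ n (f ∘ suc))) (sym (sumTo-first n (fromℕ ∘ f))))

  ⊛-congˡ : ∀ {f f′} → f ≈ₛ f′ → ∀ g → f ⊛ g ≈ₛ f′ ⊛ g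
  ⊛-congˡ e g n = sumTo-cong′ (suc n) (λ i → cong (_* g (n ∸ i)) (e i))

  ⊛-congʳ : ∀ f {g g′} → g ≈ₛ g′ → f ⊛ g ≈ₛ f ⊛ g′
  ⊛-congʳ f e n = sumTo-cong′ (suc n) (λ i → cong (f i *_) (e (n ∸ i)))

  ⊛-comm : ∀ f g → f ⊛ g ≈ₛ g ⊛ f
  ⊛-comm f g n = trans (sumTo-reverse (suc n) (λ i → f i * g (n ∸ i)))
    (sumTo-cong (suc n) (λ i i≤n → trans (cong (λ j → f (n ∸ i) * g j) (ℕP.m∸[m∸n]≡n (ℕP.≤-pred i≤n)))
                                         (ℚP.*-comm (f (n ∸ i)) (g i))))

  ⊛-distribˡ-⊖ : ∀ f g h → f ⊛ (g ⊖ h) ≈ₛ f ⊛ g ⊖ f ⊛ h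
  ⊛-distribˡ-⊖ f g h n = trans (sumTo-cong′ (suc n) (λ i → distrib (f i) (g (n ∸ i)) (h (n ∸ i)))) (sumTo-- (suc n) _ _)
    where
    distrib : ∀ a b c → a * (b - c) ≡ a * b - a * c
    distrib = solve-∀ ℚ-ring

  ⊛-distribʳ-⊕ : ∀ f g h → (g ⊕ h) ⊛ f ≈ₛ g ⊛ f ⊕ h ⊛ f
  ⊛-distribʳ-⊕ f g h n = trans (sumTo-cong′ (suc n) (λ i → ℚP.*-distribʳ-+ (f (n ∸ i)) (g i) (h i))) (sumTo-+ (suc n) _ _)

  ⊛-distribʳ-⊖ : ∀ f g h → (g ⊖ h) ⊛ f ≈ₛ g ⊛ f ⊖ h ⊛ f
  ⊛-distribʳ-⊖ f g h n = trans (sumTo-cong′ (suc n) (λ i → distrib (f (n ∸ i)) (g i) (h i))) (sumTo-- (suc n) _ _)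
    where
    distrib : ∀ a b c → (b - c) * a ≡ b * a - c * a
    distrib = solve-∀ ℚ-ring

  ⊛-·ˡ : ∀ c f g → (c ·ₛ f) ⊛ g ≈ₛ c ·ₛ (f ⊛ g)
  ⊛-·ˡ c f g n = trans (sumTo-cong′ (suc n) (λ i → ℚP.*-assoc c (f i) (g (n ∸ i)))) (sumTo-* (suc n) c _)

  ⊛-·ʳ : ∀ c f g → f ⊛ (c ·ₛ g) ≈ₛ c ·ₛ (f ⊛ g)
  ⊛-·ʳ c f g n = trans (sumTo-cong′ (suc n) (λ i → swap c (f i) (g (n ∸ i)))) (sumTo-* (suc n) c _)
    where
    swap : ∀ c a b → a * (c * b) ≡ c * (a * b)
    swap = solve-∀ ℚ-ring

  ⊛-zeroʳ : ∀ f → f ⊛ (λ _ → 0ℚ) ≈ₛ (λ _ → 0ℚ)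
  ⊛-zeroʳ f n = sumTo-zero (suc n) (λ i _ → ℚP.*-zeroʳ (f i))

  ⊛-identityˡ : ∀ f → oneₛ ⊛ f ≈ₛ f
  ⊛-identityˡ f n = trans (sumTo-first n (λ i → oneₛ i * f (n ∸ i)))
    (trans (cong₂ _+_ (ℚP.*-identityˡ (f n)) (sumTo-zero n (λ i _ → ℚP.*-zeroˡ (f (n ∸ suc i)))))
           (ℚP.+-identityʳ (f n)))

  ⊛-identityʳ : ∀ f → f ⊛ oneₛ ≈ₛ f
  ⊛-identityʳ f n = trans (⊛-comm f oneₛ n) (⊛-identityˡ f n)

  X⊛-zero : ∀ f → (Xₛ ⊛ f) 0 ≡ 0ℚ
  X⊛-zero f = trans (ℚP.+-identityˡ _) (ℚP.*-zeroˡ (f 0))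

  X⊛-suc : ∀ f n → (Xₛ ⊛ f) (suc n) ≡ f n
  X⊛-suc f n = begin
    (Xₛ ⊛ f) (suc n)
      ≡⟨ sumTo-first (suc n) (λ i → Xₛ i * f (suc n ∸ i)) ⟩
    0ℚ * f (suc n) + sumTo (suc n) (λ i → Xₛ (suc i) * f (n ∸ i))
      ≡⟨ cong₂ _+_ (ℚP.*-zeroˡ (f (suc n))) (sumTo-first n (λ i → Xₛ (suc i) * f (n ∸ i))) ⟩
    0ℚ + (1ℚ * f n + sumTo n (λ i → 0ℚ * f (n ∸ suc i)))
      ≡⟨ ℚP.+-identityˡ _ ⟩
    1ℚ * f n + sumTo n (λ i → 0ℚ * f (n ∸ suc i))
      ≡⟨ cong₂ _+_ (ℚP.*-identityˡ (f n)) (sumTo-zero n (λ i _ → ℚP.*-zeroˡ (f (n ∸ suc i)))) ⟩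
    f n + 0ℚ
      ≡⟨ ℚP.+-identityʳ (f n) ⟩
    f n ∎

  X⊛-assoc : ∀ f g → (Xₛ ⊛ f) ⊛ g ≈ₛ Xₛ ⊛ (f ⊛ g)
  X⊛-assoc f g zero    =
    trans (ℚP.+-identityˡ _) (trans (cong (_* g 0) (X⊛-zero f)) (trans (ℚP.*-zeroˡ (g 0)) (sym (X⊛-zero (f ⊛ g)))))
  X⊛-assoc f g (suc n) = begin
    ((Xₛ ⊛ f) ⊛ g) (suc n)
      ≡⟨ sumTo-first (suc n) (λ i → (Xₛ ⊛ f) i * g (suc n ∸ i)) ⟩
    (Xₛ ⊛ f) 0 * g (suc n) + sumTo (suc n) (λ i → (Xₛ ⊛ f) (suc i) * g (n ∸ i))
      ≡⟨ cong₂ _+_ (trans (cong (_* g (suc n)) (X⊛-zero f)) (ℚP.*-zeroˡ (g (suc n))))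
                   (sumTo-cong′ (suc n) (λ i → cong (_* g (n ∸ i)) (X⊛-suc f i))) ⟩
    0ℚ + (f ⊛ g) n
      ≡⟨ ℚP.+-identityˡ _ ⟩
    (f ⊛ g) n
      ≡⟨ X⊛-suc (f ⊛ g) n ⟨
    (Xₛ ⊛ (f ⊛ g)) (suc n) ∎

  X⊛-scaled-regroup : ∀ c f g h → Xₛ ⊛ (c ·ₛ ((f ⊛ g) ⊛ h)) ≈ₛ c ·ₛ Xₛ ⊛ f ⊛ g ⊛ h
  X⊛-scaled-regroup c f g h n = begin
    (Xₛ ⊛ (c ·ₛ ((f ⊛ g) ⊛ h))) n        ≡⟨ ⊛-·ʳ c Xₛ ((f ⊛ g) ⊛ h) n ⟩
    c * (Xₛ ⊛ ((f ⊛ g) ⊛ h)) n           ≡⟨ cong (c *_) (X⊛-assoc (f ⊛ g) h n) ⟨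
    c * ((Xₛ ⊛ (f ⊛ g)) ⊛ h) n           ≡⟨ cong (c *_) (⊛-congˡ (X⊛-assoc f g) h n) ⟨
    c * (((Xₛ ⊛ f) ⊛ g) ⊛ h) n           ≡⟨ ⊛-·ˡ c ((Xₛ ⊛ f) ⊛ g) h n ⟨
    ((c ·ₛ ((Xₛ ⊛ f) ⊛ g)) ⊛ h) n        ≡⟨ ⊛-congˡ (⊛-·ˡ c (Xₛ ⊛ f) g) h n ⟨
    (((c ·ₛ (Xₛ ⊛ f)) ⊛ g) ⊛ h) n        ≡⟨ ⊛-congˡ (⊛-congˡ (⊛-·ˡ c Xₛ f) g) h n ⟨
    (c ·ₛ Xₛ ⊛ f ⊛ g ⊛ h) n              ∎

module SeriesRoots where
  open RationalArithmetic using (ℚ-ring; fromℕ-*)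
  open SeriesAlgebra
  open import Data.Nat using (ℕ; zero; suc; _∸_; _≤_; z≤n; s≤s; _≤ᵇ_; _^_)
  import Data.Nat.Properties as ℕP
  open import Data.Rational using (ℚ; 0ℚ; 1ℚ; ½; _+_; _*_; _-_; -_)
  import Data.Rational.Properties as ℚP
  open import Data.Bool using (true; false; if_then_else_)
  open import Data.Sum using (inj₁; inj₂)
  open import Tactic.RingSolver using (solve-∀)
  open ≡-Reasoning

  private
    kept : ∀ {A : Set} {k n} {x y : A} → k ≤ n → (if k ≤ᵇ n then x else y) ≡ x
    kept {k = k} {n} k≤n with k ≤ᵇ n | ℕP.≤⇒≤ᵇ k≤n
    ... | true | _ = refl

    new : ∀ {A : Set} n {x y : A} → (if suc n ≤ᵇ n then x else y) ≡ y
    new zero    = refl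
    new (suc n) = new n

  module SquareRoot (f s : FPS) (s₀ : s 0 ≡ 1ℚ) (square : ∀ n → (s ⊛ s) (suc n) ≡ f (suc n)) where

    next : ∀ n → s (suc n) ≡ (f (suc n) - sumTo n (λ j → s (suc j) * s (n ∸ j))) * ½
    next n = begin
      s (suc n)                                          ≡⟨ solve (s (suc n)) S ⟩
      ((1ℚ * s (suc n) + (S + s (suc n) * 1ℚ)) - S) * ½  ≡⟨ cong (λ z → (z - S) * ½) expand ⟩
      (f (suc n) - S) * ½                                ∎
      where
      S = sumTo n (λ j → s (suc j) * s (n ∸ j))
      solve : ∀ a S → a ≡ ((1ℚ * a + (S + a * 1ℚ)) - S) * ½
      solve = solve-∀ ℚ-ring
      -- (s ⊛ s)(n+1) with its two extreme terms split off
      expand : 1ℚ * s (suc n) + (S + s (suc n) * 1ℚ) ≡ f (suc n)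
      expand = trans (cong₂ (λ x y → x * s (suc n) + (S + s (suc n) * y)) (sym s₀)
                            (trans (sym s₀) (cong s (sym (ℕP.n∸n≡0 n)))))
                     (trans (sym (sumTo-first (suc n) (λ i → s i * s (suc n ∸ i)))) (square n))

    agree : ∀ n k → k ≤ n → sqrtPre f n k ≡ s k
    agree zero    zero z≤n = sym s₀
    agree (suc n) k k≤ with ℕP.m≤n⇒m<n∨m≡n k≤
    ... | inj₁ (s≤s k≤n) = trans (kept k≤n) (agree n k k≤n)
    ... | inj₂ refl      = trans (new n)
          (trans (cong (λ z → (f (suc n) - z) * ½)
                       (sumTo-cong n (λ j j<n → cong₂ _*_ (agree n (suc j) j<n) (agree n (n ∸ j) (ℕP.m∸n≤m n j)))))
                 (sym (next n)))

    sqrt≈ : sqrtₛ f ≈ₛ s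
    sqrt≈ n = agree n n ℕP.≤-refl

  module Inverse (f v : FPS) (f₀ : f 0 ≡ 1ℚ) (v₀ : v 0 ≡ 1ℚ) (inverse : ∀ n → (f ⊛ v) (suc n) ≡ 0ℚ) where

    next : ∀ n → v (suc n) ≡ - sumTo (suc n) (λ j → f (suc j) * v (n ∸ j))
    next n = begin
      v (suc n)                        ≡⟨ solve (v (suc n)) S ⟩
      - (S - (1ℚ * v (suc n) + S))     ≡⟨ cong (λ z → - (S - (z * v (suc n) + S))) f₀ ⟨
      - (S - (f 0 * v (suc n) + S))    ≡⟨ cong (λ z → - (S - z)) (trans (sym (sumTo-first (suc n) (λ i → f i * v (suc n ∸ i)))) (inverse n)) ⟩
      - (S - 0ℚ)                       ≡⟨ cong -_ (ℚP.+-identityʳ S) ⟩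
      - S                              ∎
      where
      S = sumTo (suc n) (λ j → f (suc j) * v (n ∸ j))
      solve : ∀ a S → a ≡ - (S - (1ℚ * a + S))
      solve = solve-∀ ℚ-ring

    agree : ∀ n k → k ≤ n → invPre f n k ≡ v k
    agree zero    zero z≤n = sym v₀
    agree (suc n) k k≤ with ℕP.m≤n⇒m<n∨m≡n k≤
    ... | inj₁ (s≤s k≤n) = trans (kept k≤n) (agree n k k≤n)
    ... | inj₂ refl      = trans (new n)
          (trans (cong -_ (sumTo-cong (suc n) (λ j j≤n → cong (f (suc j) *_) (agree n (n ∸ j) (ℕP.m∸n≤m n j)))))
                 (sym (next n)))

    inv≈ : invₛ f ≈ₛ v
    inv≈ n = agree n n ℕP.≤-refl

  lin : ℚ → FPS
  lin c = oneₛ ⊕ c ·ₛ Xₛ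

  lin-⊛ : ∀ c F → lin c ⊛ F ≈ₛ F ⊕ c ·ₛ (Xₛ ⊛ F)
  lin-⊛ c F n = trans (⊛-distribʳ-⊕ F oneₛ (c ·ₛ Xₛ) n) (cong₂ _+_ (⊛-identityˡ F n) (⊛-·ˡ c Xₛ F n))

  lin-⊛-zero : ∀ c F → (lin c ⊛ F) 0 ≡ F 0
  lin-⊛-zero c F = trans (lin-⊛ c F 0)
    (trans (cong (λ z → F 0 + c * z) (X⊛-zero F)) (trans (cong (F 0 +_) (ℚP.*-zeroʳ c)) (ℚP.+-identityʳ (F 0))))

  lin-⊛-suc : ∀ c F n → (lin c ⊛ F) (suc n) ≡ F (suc n) + c * F n
  lin-⊛-suc c F n = trans (lin-⊛ c F (suc n)) (cong (λ z → F (suc n) + c * z) (X⊛-suc F n))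

  lin-⊛-assoc : ∀ c F G → (lin c ⊛ F) ⊛ G ≈ₛ lin c ⊛ (F ⊛ G)
  lin-⊛-assoc c F G n = begin
    ((lin c ⊛ F) ⊛ G) n                    ≡⟨ ⊛-congˡ (lin-⊛ c F) G n ⟩
    ((F ⊕ c ·ₛ (Xₛ ⊛ F)) ⊛ G) n            ≡⟨ ⊛-distribʳ-⊕ G F (c ·ₛ (Xₛ ⊛ F)) n ⟩
    (F ⊛ G) n + ((c ·ₛ (Xₛ ⊛ F)) ⊛ G) n    ≡⟨ cong ((F ⊛ G) n +_) (⊛-·ˡ c (Xₛ ⊛ F) G n) ⟩
    (F ⊛ G) n + c * ((Xₛ ⊛ F) ⊛ G) n      ≡⟨ cong (λ z → (F ⊛ G) n + c * z) (X⊛-assoc F G n) ⟩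
    (F ⊛ G) n + c * (Xₛ ⊛ (F ⊛ G)) n      ≡⟨ lin-⊛ c (F ⊛ G) n ⟨
    (lin c ⊛ (F ⊛ G)) n                    ∎

  lin-⊛-square : ∀ c F → (lin c ⊛ F) ⊛ (lin c ⊛ F) ≈ₛ lin c ⊛ (lin c ⊛ (F ⊛ F))
  lin-⊛-square c F n = begin
    ((lin c ⊛ F) ⊛ (lin c ⊛ F)) n     ≡⟨ lin-⊛-assoc c F (lin c ⊛ F) n ⟩
    (lin c ⊛ (F ⊛ (lin c ⊛ F))) n     ≡⟨ ⊛-congʳ (lin c) (⊛-comm F (lin c ⊛ F)) n ⟩
    (lin c ⊛ ((lin c ⊛ F) ⊛ F)) n     ≡⟨ ⊛-congʳ (lin c) (lin-⊛-assoc c F F) n ⟩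
    (lin c ⊛ (lin c ⊛ (F ⊛ F))) n     ∎

  lin-negate : ∀ c → oneₛ ⊖ c ·ₛ Xₛ ≈ₛ lin (- c)
  lin-negate c n = cong (oneₛ n +_) (ℚP.neg-distribˡ-* c (Xₛ n))

  powers : ℕ → FPS
  powers c n = fromℕ (c ^ n)

  geometric : ∀ c → lin (- fromℕ c) ⊛ powers c ≈ₛ oneₛ
  geometric c zero    = lin-⊛-zero (- fromℕ c) (powers c)
  geometric c (suc n) = trans (lin-⊛-suc (- fromℕ c) (powers c) n)
    (trans (cong (_+ (- fromℕ c * powers c n)) (fromℕ-* c (c ^ n))) (cancel (fromℕ c) (powers c n)))
    where
    cancel : ∀ c x → c * x + (- c * x) ≡ 0ℚ
    cancel = solve-∀ ℚ-ring

  inv-geometric : ∀ c → invₛ (oneₛ ⊖ fromℕ c ·ₛ Xₛ) ≈ₛ powers c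
  inv-geometric c = Inverse.inv≈ (oneₛ ⊖ fromℕ c ·ₛ Xₛ) (powers c)
    (trans (cong (λ z → 1ℚ - z) (ℚP.*-zeroʳ (fromℕ c))) (ℚP.+-identityʳ 1ℚ)) refl
    (λ n → trans (⊛-congˡ (lin-negate (fromℕ c)) (powers c) (suc n)) (geometric c (suc n)))

module Substitution where
  open RationalArithmetic using (ℚ-ring)
  open SeriesAlgebra
  open BinomialFacts using (double-suc)
  open import Data.Nat as ℕ using (zero; suc; _∸_; _<_; s≤s)
  import Data.Nat.Properties as ℕP
  open import Data.Rational using (0ℚ; _+_; _*_)
  import Data.Rational.Properties as ℚP
  open import Data.Sum using (_⊎_; inj₁; inj₂)
  open import Data.Product using (∃; _,_)
  open import Tactic.RingSolver using (solve-∀)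
  open ≡-Reasoning

  sq-even : ∀ f m → sq f (2 ℕ.* m) ≡ f m
  sq-even f zero    = refl
  sq-even f (suc m) = trans (cong (sq f) (double-suc m)) (sq-even (f ∘ suc) m)

  sq-odd : ∀ f m → sq f (suc (2 ℕ.* m)) ≡ 0ℚ
  sq-odd f zero    = refl
  sq-odd f (suc m) = trans (cong (sq f ∘ suc) (double-suc m)) (sq-odd (f ∘ suc) m)

  by-parity : ∀ (f g : FPS) → (∀ m → f (2 ℕ.* m) ≡ g (2 ℕ.* m)) →
              (∀ m → f (suc (2 ℕ.* m)) ≡ g (suc (2 ℕ.* m))) → f ≈ₛ g
  by-parity f g even odd n with half n
    where
    half : ∀ n → ∃ λ m → n ≡ 2 ℕ.* m ⊎ n ≡ suc (2 ℕ.* m)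
    half zero = 0 , inj₁ refl
    half (suc n) with half n
    ... | m , inj₁ e = m , inj₂ (cong suc e)
    ... | m , inj₂ e = suc m , inj₁ (trans (cong suc e) (sym (double-suc m)))
  ... | m , inj₁ refl = even m
  ... | m , inj₂ refl = odd m

  sq-cong : ∀ {f g} → f ≈ₛ g → sq f ≈ₛ sq g
  sq-cong {f} {g} e = by-parity (sq f) (sq g)
    (λ m → trans (sq-even f m) (trans (e m) (sym (sq-even g m))))
    (λ m → trans (sq-odd f m) (sym (sq-odd g m)))

  sq-scale : ∀ c f → sq (c ·ₛ f) ≈ₛ c ·ₛ sq f
  sq-scale c f = by-parity (sq (c ·ₛ f)) (c ·ₛ sq f)
    (λ m → trans (sq-even (c ·ₛ f) m) (cong (c *_) (sym (sq-even f m))))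
    (λ m → trans (sq-odd (c ·ₛ f) m) (sym (trans (cong (c *_) (sq-odd f m)) (ℚP.*-zeroʳ c))))

  sumTo-parity : ∀ k h → sumTo (2 ℕ.* k) h ≡ sumTo k (λ j → h (2 ℕ.* j)) + sumTo k (λ j → h (suc (2 ℕ.* j)))
  sumTo-parity zero    h = sym (ℚP.+-identityʳ 0ℚ)
  sumTo-parity (suc k) h = trans (cong (λ z → sumTo z h) (double-suc k))
    (trans (cong (λ z → z + h (2 ℕ.* k) + h (suc (2 ℕ.* k))) (sumTo-parity k h))
           (regroup (sumTo k (λ j → h (2 ℕ.* j))) (sumTo k (λ j → h (suc (2 ℕ.* j)))) (h (2 ℕ.* k)) (h (suc (2 ℕ.* k)))))
    where
    regroup : ∀ a b c d → a + b + c + d ≡ (a + c) + (b + d)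
    regroup = solve-∀ ℚ-ring

  -- in (sq f ⊛ g) only the terms with an even index of f survive
  sq⊛-even : ∀ f g m → (sq f ⊛ g) (2 ℕ.* m) ≡ (f ⊛ (λ j → g (2 ℕ.* j))) m
  sq⊛-even f g m = begin
    sumTo (2 ℕ.* m) H + H (2 ℕ.* m)
      ≡⟨ cong (_+ H (2 ℕ.* m)) (sumTo-parity m H) ⟩
    sumTo m (λ j → H (2 ℕ.* j)) + sumTo m (λ j → H (suc (2 ℕ.* j))) + H (2 ℕ.* m)
      ≡⟨ cong₂ (λ x y → x + y + H (2 ℕ.* m)) (sumTo-cong′ m even) (sumTo-zero m (λ j _ → odd j)) ⟩
    sumTo m (λ j → f j * g (2 ℕ.* (m ∸ j))) + 0ℚ + H (2 ℕ.* m)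
      ≡⟨ cong₂ _+_ (ℚP.+-identityʳ (sumTo m (λ j → f j * g (2 ℕ.* (m ∸ j))))) (even m) ⟩
    sumTo m (λ j → f j * g (2 ℕ.* (m ∸ j))) + f m * g (2 ℕ.* (m ∸ m)) ∎
    where
    H = λ i → sq f i * g (2 ℕ.* m ∸ i)
    even : ∀ j → H (2 ℕ.* j) ≡ f j * g (2 ℕ.* (m ∸ j))
    even j = cong₂ _*_ (sq-even f j) (cong g (sym (ℕP.*-distribˡ-∸ 2 m j)))
    odd : ∀ j → H (suc (2 ℕ.* j)) ≡ 0ℚ
    odd j = trans (cong (_* g (2 ℕ.* m ∸ suc (2 ℕ.* j))) (sq-odd f j)) (ℚP.*-zeroˡ (g (2 ℕ.* m ∸ suc (2 ℕ.* j))))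

  sq⊛-odd : ∀ f g m → (sq f ⊛ g) (suc (2 ℕ.* m)) ≡ (f ⊛ (λ j → g (suc (2 ℕ.* j)))) m
  sq⊛-odd f g m = begin
    sumTo (suc (suc (2 ℕ.* m))) H
      ≡⟨ cong (λ z → sumTo z H) (double-suc m) ⟨
    sumTo (2 ℕ.* suc m) H
      ≡⟨ sumTo-parity (suc m) H ⟩
    sumTo (suc m) (λ j → H (2 ℕ.* j)) + sumTo (suc m) (λ j → H (suc (2 ℕ.* j)))
      ≡⟨ cong₂ _+_ (sumTo-cong (suc m) even) (sumTo-zero (suc m) (λ j _ → odd j)) ⟩
    sumTo (suc m) (λ j → f j * g (suc (2 ℕ.* (m ∸ j)))) + 0ℚ
      ≡⟨ ℚP.+-identityʳ _ ⟩
    sumTo (suc m) (λ j → f j * g (suc (2 ℕ.* (m ∸ j)))) ∎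
    where
    H = λ i → sq f i * g (suc (2 ℕ.* m) ∸ i)
    even : ∀ j → j < suc m → H (2 ℕ.* j) ≡ f j * g (suc (2 ℕ.* (m ∸ j)))
    even j (s≤s j≤m) = cong₂ _*_ (sq-even f j)
      (cong g (trans (ℕP.+-∸-assoc 1 (ℕP.*-monoʳ-≤ 2 j≤m)) (cong suc (sym (ℕP.*-distribˡ-∸ 2 m j)))))
    odd : ∀ j → H (suc (2 ℕ.* j)) ≡ 0ℚ
    odd j = trans (cong (_* g (suc (2 ℕ.* m) ∸ suc (2 ℕ.* j))) (sq-odd f j)) (ℚP.*-zeroˡ (g (suc (2 ℕ.* m) ∸ suc (2 ℕ.* j))))

  sq-⊛ : ∀ f g → sq f ⊛ sq g ≈ₛ sq (f ⊛ g)
  sq-⊛ f g = by-parity (sq f ⊛ sq g) (sq (f ⊛ g))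
    (λ m → trans (sq⊛-even f (sq g) m) (trans (⊛-congʳ f (sq-even g) m) (sym (sq-even (f ⊛ g) m))))
    (λ m → trans (sq⊛-odd f (sq g) m)
                 (trans (trans (⊛-congʳ f (sq-odd g) m) (⊛-zeroʳ f m)) (sym (sq-odd (f ⊛ g) m))))

module CentralConvolution where
  open RangeSums
  open BinomialFacts using (central; central-recurrence)
  open import Data.Nat using (ℕ; zero; suc; _+_; _*_; _∸_; _^_)
  import Data.Nat.Properties as ℕP
  open import Data.Nat.Tactic.RingSolver using (solve-∀)
  open ≡-Reasoning

  term : ℕ → ℕ → ℕ
  term n i = central i * central (n ∸ i)

  convolution moment : ℕ → ℕ
  convolution n = sumℕ (suc n) (term n)
  moment      n = sumℕ (suc n) (λ i → i * term n i)

  -- the terms are symmetric under i ↦ n - i, so the mean index is n/2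
  moment-symmetry : ∀ n → moment n + moment n ≡ n * convolution n
  moment-symmetry n = begin
    moment n + moment n
      ≡⟨ cong (moment n +_) reflected ⟩
    moment n + sumℕ (suc n) (λ i → (n ∸ i) * term n i)
      ≡⟨ sumℕ-+ (suc n) (λ i → i * term n i) (λ i → (n ∸ i) * term n i) ⟨
    sumℕ (suc n) (λ i → i * term n i + (n ∸ i) * term n i)
      ≡⟨ sumℕ-cong (suc n) (λ i i≤n → trans (sym (ℕP.*-distribʳ-+ (term n i) i (n ∸ i)))
                                            (cong (_* term n i) (ℕP.m+[n∸m]≡n (ℕP.≤-pred i≤n)))) ⟩
    sumℕ (suc n) (λ i → n * term n i)
      ≡⟨ sumℕ-* (suc n) n (term n) ⟩
    n * convolution n ∎
    where
    reflected : moment n ≡ sumℕ (suc n) (λ i → (n ∸ i) * term n i)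
    reflected = trans (sumℕ-reverse (suc n) (λ i → i * term n i))
      (sumℕ-cong (suc n) (λ i i≤n → cong ((n ∸ i) *_)
        (trans (cong (λ j → central (n ∸ i) * central j) (ℕP.m∸[m∸n]≡n (ℕP.≤-pred i≤n)))
               (ℕP.*-comm (central (n ∸ i)) (central i)))))

  -- shifting the index with (i+1) C(2i+2,i+1) = 2(2i+1) C(2i,i)
  moment-suc : ∀ n → moment (suc n) ≡ 4 * moment n + 2 * convolution n
  moment-suc n = begin
    0 * term (suc n) 0 + sumℕ (suc n) (λ i → suc i * (central (suc i) * central (n ∸ i)))
      ≡⟨ sumℕ-cong (suc n) (λ i _ → trans (sym (ℕP.*-assoc (suc i) (central (suc i)) (central (n ∸ i))))
           (trans (cong (_* central (n ∸ i)) (central-recurrence i)) (expand i (central i) (central (n ∸ i))))) ⟩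
    sumℕ (suc n) (λ i → 4 * (i * term n i) + 2 * term n i)
      ≡⟨ sumℕ-+ (suc n) (λ i → 4 * (i * term n i)) (λ i → 2 * term n i) ⟩
    sumℕ (suc n) (λ i → 4 * (i * term n i)) + sumℕ (suc n) (λ i → 2 * term n i)
      ≡⟨ cong₂ _+_ (sumℕ-* (suc n) 4 (λ i → i * term n i)) (sumℕ-* (suc n) 2 (term n)) ⟩
    4 * moment n + 2 * convolution n ∎
    where
    expand : ∀ i x y → 2 * suc (2 * i) * x * y ≡ 4 * (i * (x * y)) + 2 * (x * y)
    expand = solve-∀

  central-convolution : ∀ n → convolution n ≡ 4 ^ n
  central-convolution zero    = refl
  central-convolution (suc n) =
    trans (ℕP.*-cancelˡ-≡ (convolution (suc n)) (4 * convolution n) (suc n) scaled)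
          (cong (4 *_) (central-convolution n))
    where
    scaled : suc n * convolution (suc n) ≡ suc n * (4 * convolution n)
    scaled = begin
      suc n * convolution (suc n)                           ≡⟨ moment-symmetry (suc n) ⟨
      moment (suc n) + moment (suc n)                       ≡⟨ cong (λ z → z + z) (moment-suc n) ⟩
      (4 * moment n + 2 * convolution n) + (4 * moment n + 2 * convolution n)
                                                            ≡⟨ regroup (moment n) (convolution n) ⟩
      4 * (moment n + moment n) + 4 * convolution n         ≡⟨ cong (λ z → 4 * z + 4 * convolution n) (moment-symmetry n) ⟩
      4 * (n * convolution n) + 4 * convolution n           ≡⟨ factor n (convolution n) ⟩
      suc n * (4 * convolution n)                           ∎
      where
      regroup : ∀ x y → (4 * x + 2 * y) + (4 * x + 2 * y) ≡ 4 * (x + x) + 4 * y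
      regroup = solve-∀
      factor : ∀ n y → 4 * (n * y) + 4 * y ≡ suc n * (4 * y)
      factor = solve-∀

module CatalanSeries where
  open RationalArithmetic
  open SeriesAlgebra
  open SeriesRoots
  open BinomialFacts using (central; central-recurrence)
  open CentralConvolution using (term; central-convolution)
  open import Data.Nat as ℕ using (zero; suc; _∸_)
  import Data.Nat.Properties as ℕP
  open import Data.Rational using (0ℚ; 1ℚ; ½; _+_; _*_; _-_; -_)
  import Data.Rational.Properties as ℚP
  open import Tactic.RingSolver using (solve-∀)
  open ≡-Reasoning

  B⊛B : Bₛ ⊛ Bₛ ≈ₛ powers 4
  B⊛B n = trans (sumTo-cong′ (suc n) (λ i → sym (fromℕ-* (central i) (central (n ∸ i)))))
    (trans (sym (fromℕ-sumℕ (suc n) (term n))) (cong fromℕ (central-convolution n)))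

  root : FPS
  root = lin (- fromℕ 4) ⊛ Bₛ

  lin⊛B⊛B : lin (- fromℕ 4) ⊛ (Bₛ ⊛ Bₛ) ≈ₛ oneₛ
  lin⊛B⊛B n = trans (⊛-congʳ (lin (- fromℕ 4)) B⊛B n) (geometric 4 n)

  root⊛B : root ⊛ Bₛ ≈ₛ oneₛ
  root⊛B n = trans (lin-⊛-assoc (- fromℕ 4) Bₛ Bₛ n) (lin⊛B⊛B n)

  sqrt-1-4x : sqrtₛ (oneₛ ⊖ fromℕ 4 ·ₛ Xₛ) ≈ₛ root
  sqrt-1-4x = SquareRoot.sqrt≈ (oneₛ ⊖ fromℕ 4 ·ₛ Xₛ) root (lin-⊛-zero (- fromℕ 4) Bₛ) λ n → begin
    (root ⊛ root) (suc n)                                      ≡⟨ lin-⊛-square (- fromℕ 4) Bₛ (suc n) ⟩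
    (lin (- fromℕ 4) ⊛ (lin (- fromℕ 4) ⊛ (Bₛ ⊛ Bₛ))) (suc n)  ≡⟨ ⊛-congʳ (lin (- fromℕ 4)) lin⊛B⊛B (suc n) ⟩
    (lin (- fromℕ 4) ⊛ oneₛ) (suc n)                           ≡⟨ ⊛-identityʳ (lin (- fromℕ 4)) (suc n) ⟩
    lin (- fromℕ 4) (suc n)                                    ≡⟨ lin-negate (fromℕ 4) (suc n) ⟨
    (oneₛ ⊖ fromℕ 4 ·ₛ Xₛ) (suc n)                             ∎

  C-coefficient : ∀ n → Cₛ n ≡ ½ * (fromℕ 4 * Bₛ n - Bₛ (suc n))
  C-coefficient n = begin
    ½ * (0ℚ - sqrtₛ (oneₛ ⊖ fromℕ 4 ·ₛ Xₛ) (suc n))   ≡⟨ cong (λ z → ½ * (0ℚ - z)) (sqrt-1-4x (suc n)) ⟩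
    ½ * (0ℚ - root (suc n))                          ≡⟨ cong (λ z → ½ * (0ℚ - z)) (lin-⊛-suc (- fromℕ 4) Bₛ n) ⟩
    ½ * (0ℚ - (Bₛ (suc n) + - fromℕ 4 * Bₛ n))       ≡⟨ solve (Bₛ (suc n)) (Bₛ n) ⟩
    ½ * (fromℕ 4 * Bₛ n - Bₛ (suc n))                ∎
    where
    solve : ∀ x y → ½ * (0ℚ - (x + - fromℕ 4 * y)) ≡ ½ * (fromℕ 4 * y - x)
    solve = solve-∀ ℚ-ring

  central-recurrenceℚ : ∀ m → fromℕ (suc m) * Bₛ (suc m) ≡ fromℕ 2 * (fromℕ 2 * fromℕ m + 1ℚ) * Bₛ m
  central-recurrenceℚ m = begin
    fromℕ (suc m) * Bₛ (suc m)                 ≡⟨ fromℕ-* (suc m) (central (suc m)) ⟨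
    fromℕ (suc m ℕ.* central (suc m))          ≡⟨ cong fromℕ (central-recurrence m) ⟩
    fromℕ (2 ℕ.* suc (2 ℕ.* m) ℕ.* central m)  ≡⟨ fromℕ-* (2 ℕ.* suc (2 ℕ.* m)) (central m) ⟩
    fromℕ (2 ℕ.* suc (2 ℕ.* m)) * Bₛ m         ≡⟨ cong (_* Bₛ m) (fromℕ-* 2 (suc (2 ℕ.* m))) ⟩
    fromℕ 2 * fromℕ (suc (2 ℕ.* m)) * Bₛ m     ≡⟨ cong (λ z → fromℕ 2 * z * Bₛ m) (trans (cong fromℕ (ℕP.+-comm 1 (2 ℕ.* m))) (fromℕ-*+ 2 m 1)) ⟩
    fromℕ 2 * (fromℕ 2 * fromℕ m + 1ℚ) * Bₛ m  ∎

  C-quotient : ∀ n → Cₛ n ≡ divℕ (Bₛ n) (suc n)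
  C-quotient n = sym (divℕ-unique (Bₛ n) n (Cₛ n) (begin
    Cₛ n * fromℕ (suc n)
      ≡⟨ cong (_* fromℕ (suc n)) (C-coefficient n) ⟩
    ½ * (fromℕ 4 * Bₛ n - Bₛ (suc n)) * fromℕ (suc n)
      ≡⟨ expand (Bₛ n) (Bₛ (suc n)) (fromℕ (suc n)) ⟩
    fromℕ 2 * Bₛ n * fromℕ (suc n) - ½ * (fromℕ (suc n) * Bₛ (suc n))
      ≡⟨ cong₂ (λ x y → fromℕ 2 * Bₛ n * x - ½ * y) (fromℕ-suc n) (central-recurrenceℚ n) ⟩
    fromℕ 2 * Bₛ n * (fromℕ n + 1ℚ) - ½ * (fromℕ 2 * (fromℕ 2 * fromℕ n + 1ℚ) * Bₛ n)
      ≡⟨ cancel (Bₛ n) (fromℕ n) ⟩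
    Bₛ n ∎))
    where
    expand : ∀ B B′ s → ½ * (fromℕ 4 * B - B′) * s ≡ fromℕ 2 * B * s - ½ * (s * B′)
    expand = solve-∀ ℚ-ring
    cancel : ∀ B m → fromℕ 2 * B * (m + 1ℚ) - ½ * (fromℕ 2 * (fromℕ 2 * m + 1ℚ) * B) ≡ B
    cancel = solve-∀ ℚ-ring

  X⊛C : Xₛ ⊛ Cₛ ≈ₛ ½ ·ₛ (oneₛ ⊖ root)
  X⊛C zero    = trans (X⊛-zero Cₛ) (cong (λ z → ½ * (1ℚ - z)) (sym (lin-⊛-zero (- fromℕ 4) Bₛ)))
  X⊛C (suc n) = trans (X⊛-suc Cₛ n) (cong (λ z → ½ * (0ℚ - z)) (sqrt-1-4x (suc n)))

  C⊛B : ∀ m → (Cₛ ⊛ Bₛ) m ≡ ½ * Bₛ (suc m)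
  C⊛B m = begin
    (Cₛ ⊛ Bₛ) m                                    ≡⟨ X⊛-suc (Cₛ ⊛ Bₛ) m ⟨
    (Xₛ ⊛ (Cₛ ⊛ Bₛ)) (suc m)                       ≡⟨ X⊛-assoc Cₛ Bₛ (suc m) ⟨
    ((Xₛ ⊛ Cₛ) ⊛ Bₛ) (suc m)                       ≡⟨ ⊛-congˡ X⊛C Bₛ (suc m) ⟩
    ((½ ·ₛ (oneₛ ⊖ root)) ⊛ Bₛ) (suc m)            ≡⟨ ⊛-·ˡ ½ (oneₛ ⊖ root) Bₛ (suc m) ⟩
    ½ * ((oneₛ ⊖ root) ⊛ Bₛ) (suc m)               ≡⟨ cong (½ *_) (⊛-distribʳ-⊖ Bₛ oneₛ root (suc m)) ⟩
    ½ * ((oneₛ ⊛ Bₛ) (suc m) - (root ⊛ Bₛ) (suc m)) ≡⟨ cong₂ (λ x y → ½ * (x - y)) (⊛-identityˡ Bₛ (suc m)) (root⊛B (suc m)) ⟩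
    ½ * (Bₛ (suc m) - 0ℚ)                          ≡⟨ cong (½ *_) (ℚP.+-identityʳ (Bₛ (suc m))) ⟩
    ½ * Bₛ (suc m)                                 ∎

  B⊛C : Bₛ ⊛ Cₛ ≈ₛ ½ ·ₛ divX Bₛ
  B⊛C n = trans (⊛-comm Bₛ Cₛ n) (C⊛B n)

  divX-B⊛ : ∀ F m → (divX Bₛ ⊛ F) m ≡ (Bₛ ⊛ F) (suc m) - F (suc m)
  divX-B⊛ F m = begin
    (divX Bₛ ⊛ F) m                            ≡⟨ X⊛-suc (divX Bₛ ⊛ F) m ⟨
    (Xₛ ⊛ (divX Bₛ ⊛ F)) (suc m)               ≡⟨ X⊛-assoc (divX Bₛ) F (suc m) ⟨
    ((Xₛ ⊛ divX Bₛ) ⊛ F) (suc m)               ≡⟨ ⊛-congˡ X⊛divX-B F (suc m) ⟩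
    ((Bₛ ⊖ oneₛ) ⊛ F) (suc m)                  ≡⟨ ⊛-distribʳ-⊖ F Bₛ oneₛ (suc m) ⟩
    (Bₛ ⊛ F) (suc m) - (oneₛ ⊛ F) (suc m)      ≡⟨ cong (λ z → (Bₛ ⊛ F) (suc m) - z) (⊛-identityˡ F (suc m)) ⟩
    (Bₛ ⊛ F) (suc m) - F (suc m)               ∎
    where
    X⊛divX-B : Xₛ ⊛ divX Bₛ ≈ₛ Bₛ ⊖ oneₛ
    X⊛divX-B zero    = X⊛-zero (divX Bₛ)
    X⊛divX-B (suc n) = trans (X⊛-suc (divX Bₛ) n) (sym (ℚP.+-identityʳ (Bₛ (suc n))))

module PathSeries where
  open RationalArithmetic
  open SeriesAlgebra
  open SeriesRoots
  open Substitution
  open CatalanSeries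
  open BinomialFacts using (central; central-suc; pascal; double-suc)
  open PathNumbers using (paths⁺; returns)
  open PathNumberFormulas using (catalan; returns-odd; paths⁺-even; paths⁺-odd)
  open import Data.Nat as ℕ using (zero; suc; _^_)
  import Data.Nat.Properties as ℕP
  open import Data.Nat.Combinatorics using (_C_)
  open import Data.Nat.Tactic.RingSolver as ℕSolver using ()
  open import Data.Rational using (0ℚ; ½; _+_; _*_; _-_; -_)
  import Data.Rational.Properties as ℚP
  open import Tactic.RingSolver using (solve-∀)
  open ≡-Reasoning

  returnsₛ paths⁺ₛ : FPS
  returnsₛ n = fromℕ (returns n 0)
  paths⁺ₛ  n = fromℕ (paths⁺ n 0)

  half-difference : ∀ x y z → 2 ℕ.* x ℕ.+ y ≡ z → fromℕ x ≡ ½ * (fromℕ z - fromℕ y)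
  half-difference x y z e = begin
    fromℕ x                                         ≡⟨ solve (fromℕ x) (fromℕ y) ⟩
    ½ * ((fromℕ 2 * fromℕ x + fromℕ y) - fromℕ y)   ≡⟨ cong (λ u → ½ * (u - fromℕ y)) (fromℕ-*+ 2 x y) ⟨
    ½ * (fromℕ (2 ℕ.* x ℕ.+ y) - fromℕ y)           ≡⟨ cong (λ u → ½ * (fromℕ u - fromℕ y)) e ⟩
    ½ * (fromℕ z - fromℕ y)                         ∎
    where
    solve : ∀ x y → x ≡ ½ * ((fromℕ 2 * x + y) - y)
    solve = solve-∀ ℚ-ring

  catalan-central : ∀ m → 2 ℕ.* returns (2 ℕ.* m) 0 ℕ.+ central (suc m) ≡ 4 ℕ.* central m
  catalan-central m = begin
    2 ℕ.* r ℕ.+ central (suc m)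
      ≡⟨ cong (2 ℕ.* r ℕ.+_) (trans (central-suc m) (cong (2 ℕ.*_) (sym (pascal (2 ℕ.* m) m)))) ⟩
    2 ℕ.* r ℕ.+ 2 ℕ.* (central m ℕ.+ c)
      ≡⟨ regroup r (central m) c ⟩
    2 ℕ.* (r ℕ.+ c) ℕ.+ 2 ℕ.* central m
      ≡⟨ cong (λ z → 2 ℕ.* z ℕ.+ 2 ℕ.* central m) (catalan m) ⟩
    2 ℕ.* central m ℕ.+ 2 ℕ.* central m
      ≡⟨ double (central m) ⟩
    4 ℕ.* central m ∎
    where
    r = returns (2 ℕ.* m) 0
    c = (2 ℕ.* m) C suc m
    regroup : ∀ x y c → 2 ℕ.* x ℕ.+ 2 ℕ.* (y ℕ.+ c) ≡ 2 ℕ.* (x ℕ.+ c) ℕ.+ 2 ℕ.* y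
    regroup = ℕSolver.solve-∀
    double : ∀ y → 2 ℕ.* y ℕ.+ 2 ℕ.* y ≡ 4 ℕ.* y
    double = ℕSolver.solve-∀

  returns-series : sq Cₛ ≈ₛ returnsₛ
  returns-series = by-parity (sq Cₛ) returnsₛ
    (λ m → begin
      sq Cₛ (2 ℕ.* m)                                   ≡⟨ sq-even Cₛ m ⟩
      Cₛ m                                              ≡⟨ C-coefficient m ⟩
      ½ * (fromℕ 4 * Bₛ m - Bₛ (suc m))                 ≡⟨ cong (λ u → ½ * (u - Bₛ (suc m))) (fromℕ-* 4 (central m)) ⟨
      ½ * (fromℕ (4 ℕ.* central m) - Bₛ (suc m))        ≡⟨ half-difference (returns (2 ℕ.* m) 0) (central (suc m)) (4 ℕ.* central m) (catalan-central m) ⟨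
      returnsₛ (2 ℕ.* m)                                ∎)
    (λ m → trans (sq-odd Cₛ m) (sym (cong fromℕ (returns-odd m))))

  paths⁺ₛ-even : ∀ m → paths⁺ₛ (2 ℕ.* m) ≡ Bₛ m
  paths⁺ₛ-even m = cong fromℕ (paths⁺-even m)

  paths⁺ₛ-odd : ∀ m → paths⁺ₛ (suc (2 ℕ.* m)) ≡ ½ * Bₛ (suc m)
  paths⁺ₛ-odd m = trans (half-difference (paths⁺ (suc (2 ℕ.* m)) 0) 0 (central (suc m)) doubled) (cong (½ *_) (ℚP.+-identityʳ (Bₛ (suc m))))
    where
    doubled : 2 ℕ.* paths⁺ (suc (2 ℕ.* m)) 0 ℕ.+ 0 ≡ central (suc m)
    doubled = trans (ℕP.+-identityʳ _) (trans (cong (2 ℕ.*_) (paths⁺-odd m)) (sym (central-suc m)))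

  lin⊛sq-powers : ∀ c → lin (fromℕ c) ⊛ sq (powers (c ^ 2)) ≈ₛ powers c
  lin⊛sq-powers c = by-parity (lin (fromℕ c) ⊛ sq (powers (c ^ 2))) (powers c) even odd
    where
    squares : ∀ m → (c ^ 2) ^ m ≡ c ^ (2 ℕ.* m)
    squares m = ℕP.^-*-assoc c 2 m
    even : ∀ m → (lin (fromℕ c) ⊛ sq (powers (c ^ 2))) (2 ℕ.* m) ≡ powers c (2 ℕ.* m)
    even zero    = lin-⊛-zero (fromℕ c) (sq (powers (c ^ 2)))
    even (suc m) = begin
      (lin (fromℕ c) ⊛ sq (powers (c ^ 2))) (2 ℕ.* suc m)
        ≡⟨ cong (lin (fromℕ c) ⊛ sq (powers (c ^ 2))) (double-suc m) ⟩
      (lin (fromℕ c) ⊛ sq (powers (c ^ 2))) (suc (suc (2 ℕ.* m)))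
        ≡⟨ lin-⊛-suc (fromℕ c) (sq (powers (c ^ 2))) (suc (2 ℕ.* m)) ⟩
      sq (powers (c ^ 2)) (suc (suc (2 ℕ.* m))) + fromℕ c * sq (powers (c ^ 2)) (suc (2 ℕ.* m))
        ≡⟨ cong₂ (λ x y → x + fromℕ c * y) (trans (cong (sq (powers (c ^ 2))) (sym (double-suc m)))
                                                   (sq-even (powers (c ^ 2)) (suc m)))
                                            (sq-odd (powers (c ^ 2)) m) ⟩
      powers (c ^ 2) (suc m) + fromℕ c * 0ℚ
        ≡⟨ trans (cong (powers (c ^ 2) (suc m) +_) (ℚP.*-zeroʳ (fromℕ c))) (ℚP.+-identityʳ _) ⟩
      powers (c ^ 2) (suc m)
        ≡⟨ cong fromℕ (squares (suc m)) ⟩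
      powers c (2 ℕ.* suc m) ∎
    odd : ∀ m → (lin (fromℕ c) ⊛ sq (powers (c ^ 2))) (suc (2 ℕ.* m)) ≡ powers c (suc (2 ℕ.* m))
    odd m = begin
      (lin (fromℕ c) ⊛ sq (powers (c ^ 2))) (suc (2 ℕ.* m))
        ≡⟨ lin-⊛-suc (fromℕ c) (sq (powers (c ^ 2))) (2 ℕ.* m) ⟩
      sq (powers (c ^ 2)) (suc (2 ℕ.* m)) + fromℕ c * sq (powers (c ^ 2)) (2 ℕ.* m)
        ≡⟨ cong₂ (λ x y → x + fromℕ c * y) (sq-odd (powers (c ^ 2)) m) (sq-even (powers (c ^ 2)) m) ⟩
      0ℚ + fromℕ c * powers (c ^ 2) m
        ≡⟨ ℚP.+-identityˡ _ ⟩
      fromℕ c * powers (c ^ 2) m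
        ≡⟨ fromℕ-* c ((c ^ 2) ^ m) ⟨
      fromℕ (c ℕ.* (c ^ 2) ^ m)
        ≡⟨ cong (λ z → fromℕ (c ℕ.* z)) (squares m) ⟩
      powers c (suc (2 ℕ.* m)) ∎

  ratio ratioRoot : FPS
  ratio     = (oneₛ ⊕ fromℕ 2 ·ₛ Xₛ) ⊛ invₛ (oneₛ ⊖ fromℕ 2 ·ₛ Xₛ)
  ratioRoot = lin (fromℕ 2) ⊛ sq Bₛ

  ratioRoot-square : ratioRoot ⊛ ratioRoot ≈ₛ ratio
  ratioRoot-square n = begin
    (ratioRoot ⊛ ratioRoot) n                         ≡⟨ lin-⊛-square (fromℕ 2) (sq Bₛ) n ⟩
    (L ⊛ (L ⊛ (sq Bₛ ⊛ sq Bₛ))) n                     ≡⟨ ⊛-congʳ L (⊛-congʳ L (sq-⊛ Bₛ Bₛ)) n ⟩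
    (L ⊛ (L ⊛ sq (Bₛ ⊛ Bₛ))) n                        ≡⟨ ⊛-congʳ L (⊛-congʳ L (sq-cong B⊛B)) n ⟩
    (L ⊛ (L ⊛ sq (powers (2 ^ 2)))) n                 ≡⟨ ⊛-congʳ L (lin⊛sq-powers 2) n ⟩
    (L ⊛ powers 2) n                                  ≡⟨ ⊛-congʳ L (inv-geometric 2) n ⟨
    ratio n                                           ∎
    where L = lin (fromℕ 2)

  sqrt-ratio : sqrtₛ ratio ≈ₛ ratioRoot
  sqrt-ratio = SquareRoot.sqrt≈ ratio ratioRoot (lin-⊛-zero (fromℕ 2) (sq Bₛ)) (λ n → ratioRoot-square (suc n))

  paths⁺-series : ½ ·ₛ divX (sqrtₛ ratio ⊖ oneₛ) ≈ₛ paths⁺ₛ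
  paths⁺-series n = trans (cong (λ z → ½ * (z - 0ℚ)) (trans (sqrt-ratio (suc n)) (lin-⊛-suc (fromℕ 2) (sq Bₛ) n)))
                          (by-parity coefficient paths⁺ₛ even odd n)
    where
    coefficient : FPS
    coefficient n = ½ * ((sq Bₛ (suc n) + fromℕ 2 * sq Bₛ n) - 0ℚ)
    even : ∀ m → coefficient (2 ℕ.* m) ≡ paths⁺ₛ (2 ℕ.* m)
    even m = trans (cong₂ (λ x y → ½ * ((x + fromℕ 2 * y) - 0ℚ)) (sq-odd Bₛ m) (sq-even Bₛ m))
                   (trans (solve (Bₛ m)) (sym (paths⁺ₛ-even m)))
      where
      solve : ∀ x → ½ * ((0ℚ + fromℕ 2 * x) - 0ℚ) ≡ x
      solve = solve-∀ ℚ-ring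
    odd : ∀ m → coefficient (suc (2 ℕ.* m)) ≡ paths⁺ₛ (suc (2 ℕ.* m))
    odd m = trans (cong₂ (λ x y → ½ * ((x + fromℕ 2 * y) - 0ℚ))
                         (trans (cong (sq Bₛ) (sym (double-suc m))) (sq-even Bₛ (suc m))) (sq-odd Bₛ m))
                  (trans (solve (Bₛ (suc m))) (sym (paths⁺ₛ-odd m)))
      where
      solve : ∀ x → ½ * ((x + fromℕ 2 * 0ℚ) - 0ℚ) ≡ ½ * x
      solve = solve-∀ ℚ-ring

module TSeries where
  open RationalArithmetic
  open SeriesAlgebra
  open Substitution
  open CatalanSeries
  open PathSeries
  open BinomialFacts using (central; central-suc-suc; double-suc)
  open PathNumbers using (visits; returns; paths⁺; T≡visits+returns)
  open PathNumberFormulas using (visits-decomposition)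
  open import Data.Nat as ℕ using (zero; suc; _∸_)
  import Data.Nat.Properties as ℕP
  open import Data.Nat.Combinatorics using (_C_)
  open import Data.Rational using (0ℚ; 1ℚ; ½; _+_; _*_; _-_; -_)
  import Data.Rational.Properties as ℚP
  open import Data.List using ([]; _∷_; map; upTo)
  import Data.List.Properties as LP
  open import Tactic.RingSolver using (solve-∀)
  open ≡-Reasoning

  T-coefficient : ∀ n → Tₛ n ≡ fromℕ 2 * (returnsₛ ⊛ paths⁺ₛ) n - returnsₛ n
  T-coefficient n = begin
    fromℕ (T n)
      ≡⟨ cong fromℕ (T≡visits+returns n) ⟩
    fromℕ (2 ℕ.* visits n 0 ℕ.+ returns n 0)
      ≡⟨ fromℕ-*+ 2 (visits n 0) (returns n 0) ⟩
    fromℕ 2 * fromℕ (visits n 0) + returnsₛ n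
      ≡⟨ cong (λ z → fromℕ 2 * z + returnsₛ n) visits≡ ⟩
    fromℕ 2 * V + returnsₛ n
      ≡⟨ solve V (returnsₛ n) ⟩
    fromℕ 2 * (V + returnsₛ n * 1ℚ) - returnsₛ n
      ≡⟨ cong (λ z → fromℕ 2 * (V + returnsₛ n * paths⁺ₛ z) - returnsₛ n) (ℕP.n∸n≡0 n) ⟨
    fromℕ 2 * (returnsₛ ⊛ paths⁺ₛ) n - returnsₛ n ∎
    where
    V = sumTo n (λ t → returnsₛ t * paths⁺ₛ (n ∸ t))
    visits≡ : fromℕ (visits n 0) ≡ V
    visits≡ = trans (cong fromℕ (visits-decomposition n 0))
      (trans (fromℕ-sumℕ n (λ t → returns t 0 ℕ.* paths⁺ (n ∸ t) 0))
             (sumTo-cong′ n (λ t → fromℕ-* (returns t 0) (paths⁺ (n ∸ t) 0))))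
    solve : ∀ v e → fromℕ 2 * v + e ≡ fromℕ 2 * (v + e * 1ℚ) - e
    solve = solve-∀ ℚ-ring

  generating-function :
    Tₛ ≈ₛ (fromℕ 2 ·ₛ sq Cₛ) ⊛ (½ ·ₛ divX (sqrtₛ ratio ⊖ oneₛ)) ⊖ sq Cₛ
  generating-function n = trans (T-coefficient n) (sym (cong₂ _-_
    (trans (⊛-·ˡ (fromℕ 2) (sq Cₛ) A n)
           (cong (fromℕ 2 *_) (trans (⊛-congˡ returns-series A n) (⊛-congʳ returnsₛ paths⁺-series n))))
    (returns-series n)))
    where A = ½ ·ₛ divX (sqrtₛ ratio ⊖ oneₛ)

  first-values : map T (upTo 8) ≡ 1 ∷ 2 ∷ 5 ∷ 8 ∷ 18 ∷ 30 ∷ 65 ∷ 112 ∷ []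
  first-values = LP.map-cong T≡visits+returns (upTo 8)

  convolution-even : ∀ m → (returnsₛ ⊛ paths⁺ₛ) (2 ℕ.* m) ≡ (Cₛ ⊛ Bₛ) m
  convolution-even m = trans (sym (⊛-congˡ returns-series paths⁺ₛ (2 ℕ.* m)))
    (trans (sq⊛-even Cₛ paths⁺ₛ m) (⊛-congʳ Cₛ paths⁺ₛ-even m))

  convolution-odd : ∀ m → (returnsₛ ⊛ paths⁺ₛ) (suc (2 ℕ.* m)) ≡ (Cₛ ⊛ (½ ·ₛ divX Bₛ)) m
  convolution-odd m = trans (sym (⊛-congˡ returns-series paths⁺ₛ (suc (2 ℕ.* m))))
    (trans (sq⊛-odd Cₛ paths⁺ₛ m) (⊛-congʳ Cₛ paths⁺ₛ-odd m))

  T-even : ∀ m → Tₛ (2 ℕ.* m) ≡ Bₛ (suc m) - Cₛ m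
  T-even m = begin
    Tₛ (2 ℕ.* m)                                           ≡⟨ T-coefficient (2 ℕ.* m) ⟩
    fromℕ 2 * (returnsₛ ⊛ paths⁺ₛ) (2 ℕ.* m) - returnsₛ (2 ℕ.* m)
      ≡⟨ cong₂ (λ x y → fromℕ 2 * x - y) (trans (convolution-even m) (C⊛B m))
                                          (trans (sym (returns-series (2 ℕ.* m))) (sq-even Cₛ m)) ⟩
    fromℕ 2 * (½ * Bₛ (suc m)) - Cₛ m                      ≡⟨ cong (_- Cₛ m) (solve (Bₛ (suc m))) ⟩
    Bₛ (suc m) - Cₛ m                                      ∎
    where
    solve : ∀ x → fromℕ 2 * (½ * x) ≡ x
    solve = solve-∀ ℚ-ring

  T-even-convolution : ∀ m → Tₛ (2 ℕ.* m) ≡ (Cₛ ⊛ (fromℕ 2 ·ₛ Bₛ ⊖ oneₛ)) m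
  T-even-convolution m = begin
    Tₛ (2 ℕ.* m)                                   ≡⟨ T-even m ⟩
    Bₛ (suc m) - Cₛ m                              ≡⟨ cong₂ _-_ (solve (Bₛ (suc m))) (⊛-identityʳ Cₛ m) ⟨
    fromℕ 2 * (½ * Bₛ (suc m)) - (Cₛ ⊛ oneₛ) m     ≡⟨ cong (λ z → fromℕ 2 * z - (Cₛ ⊛ oneₛ) m) (C⊛B m) ⟨
    fromℕ 2 * (Cₛ ⊛ Bₛ) m - (Cₛ ⊛ oneₛ) m          ≡⟨ cong (_- (Cₛ ⊛ oneₛ) m) (⊛-·ʳ (fromℕ 2) Cₛ Bₛ m) ⟨
    (Cₛ ⊛ (fromℕ 2 ·ₛ Bₛ)) m - (Cₛ ⊛ oneₛ) m       ≡⟨ ⊛-distribˡ-⊖ Cₛ (fromℕ 2 ·ₛ Bₛ) oneₛ m ⟨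
    (Cₛ ⊛ (fromℕ 2 ·ₛ Bₛ ⊖ oneₛ)) m                ∎
    where
    solve : ∀ x → fromℕ 2 * (½ * x) ≡ x
    solve = solve-∀ ℚ-ring

  sq-affine : ∀ c f → c ·ₛ sq f ⊖ oneₛ ≈ₛ sq (c ·ₛ f ⊖ oneₛ)
  sq-affine c f = by-parity (c ·ₛ sq f ⊖ oneₛ) (sq (c ·ₛ f ⊖ oneₛ))
    (λ m → trans (cong₂ (λ x y → c * x - y) (sq-even f m) (one-even m)) (sym (sq-even (c ·ₛ f ⊖ oneₛ) m)))
    (λ m → trans (cong (λ x → c * x - 0ℚ) (sq-odd f m))
                 (trans (solve c) (sym (sq-odd (c ·ₛ f ⊖ oneₛ) m))))
    where
    one-even : ∀ m → oneₛ (2 ℕ.* m) ≡ oneₛ m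
    one-even zero    = refl
    one-even (suc m) = cong oneₛ (double-suc m)
    solve : ∀ c → c * 0ℚ - 0ℚ ≡ 0ℚ
    solve = solve-∀ ℚ-ring

  even-part : sq (λ m → Tₛ (2 ℕ.* m)) ≈ₛ sq Cₛ ⊛ (fromℕ 2 ·ₛ sq Bₛ ⊖ oneₛ)
  even-part n = begin
    sq (λ m → Tₛ (2 ℕ.* m)) n                      ≡⟨ sq-cong T-even-convolution n ⟩
    sq (Cₛ ⊛ (fromℕ 2 ·ₛ Bₛ ⊖ oneₛ)) n             ≡⟨ sq-⊛ Cₛ (fromℕ 2 ·ₛ Bₛ ⊖ oneₛ) n ⟨
    (sq Cₛ ⊛ sq (fromℕ 2 ·ₛ Bₛ ⊖ oneₛ)) n          ≡⟨ ⊛-congʳ (sq Cₛ) (sq-affine (fromℕ 2) Bₛ) n ⟨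
    (sq Cₛ ⊛ (fromℕ 2 ·ₛ sq Bₛ ⊖ oneₛ)) n          ∎

  T-odd-convolution : ∀ m → Tₛ (2 ℕ.* m ℕ.+ 1) ≡ fromℕ 2 * ((Bₛ ⊛ Cₛ) ⊛ Cₛ) m
  T-odd-convolution m = begin
    Tₛ (2 ℕ.* m ℕ.+ 1)
      ≡⟨ cong Tₛ (ℕP.+-comm (2 ℕ.* m) 1) ⟩
    Tₛ (suc (2 ℕ.* m))
      ≡⟨ T-coefficient (suc (2 ℕ.* m)) ⟩
    fromℕ 2 * (returnsₛ ⊛ paths⁺ₛ) (suc (2 ℕ.* m)) - returnsₛ (suc (2 ℕ.* m))
      ≡⟨ cong₂ (λ x y → fromℕ 2 * x - y) (convolution-odd m)
                                          (trans (sym (returns-series (suc (2 ℕ.* m)))) (sq-odd Cₛ m)) ⟩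
    fromℕ 2 * (Cₛ ⊛ (½ ·ₛ divX Bₛ)) m - 0ℚ
      ≡⟨ ℚP.+-identityʳ _ ⟩
    fromℕ 2 * (Cₛ ⊛ (½ ·ₛ divX Bₛ)) m
      ≡⟨ cong (fromℕ 2 *_) (trans (⊛-comm Cₛ (½ ·ₛ divX Bₛ) m) (sym (⊛-congˡ B⊛C Cₛ m))) ⟩
    fromℕ 2 * ((Bₛ ⊛ Cₛ) ⊛ Cₛ) m ∎

  T-odd : ∀ m → Tₛ (2 ℕ.* m ℕ.+ 1) ≡ fromℕ (2 ℕ.* ((2 ℕ.* m ℕ.+ 2) C m))
  T-odd m = begin
    Tₛ (2 ℕ.* m ℕ.+ 1)
      ≡⟨ T-odd-convolution m ⟩
    fromℕ 2 * ((Bₛ ⊛ Cₛ) ⊛ Cₛ) m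
      ≡⟨ cong (fromℕ 2 *_) (trans (⊛-congˡ B⊛C Cₛ m) (⊛-·ˡ ½ (divX Bₛ) Cₛ m)) ⟩
    fromℕ 2 * (½ * (divX Bₛ ⊛ Cₛ) m)
      ≡⟨ cong (λ z → fromℕ 2 * (½ * z)) (divX-B⊛ Cₛ m) ⟩
    fromℕ 2 * (½ * ((Bₛ ⊛ Cₛ) (suc m) - Cₛ (suc m)))
      ≡⟨ cong₂ (λ x y → fromℕ 2 * (½ * (x - y))) (B⊛C (suc m)) (C-coefficient (suc m)) ⟩
    fromℕ 2 * (½ * (½ * Bₛ (suc (suc m)) - ½ * (fromℕ 4 * Bₛ (suc m) - Bₛ (suc (suc m)))))
      ≡⟨ solve (Bₛ (suc (suc m))) (Bₛ (suc m)) ⟩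
    Bₛ (suc (suc m)) - fromℕ 2 * Bₛ (suc m)
      ≡⟨ cong (_- fromℕ 2 * Bₛ (suc m)) (trans (cong fromℕ (central-suc-suc m))
           (trans (fromℕ-+ (2 ℕ.* ((2 ℕ.* m ℕ.+ 2) C m)) (2 ℕ.* central (suc m)))
                  (cong (fromℕ (2 ℕ.* ((2 ℕ.* m ℕ.+ 2) C m)) +_) (fromℕ-* 2 (central (suc m)))))) ⟩
    fromℕ (2 ℕ.* ((2 ℕ.* m ℕ.+ 2) C m)) + fromℕ 2 * Bₛ (suc m) - fromℕ 2 * Bₛ (suc m)
      ≡⟨ cancel (fromℕ (2 ℕ.* ((2 ℕ.* m ℕ.+ 2) C m))) (fromℕ 2 * Bₛ (suc m)) ⟩
    fromℕ (2 ℕ.* ((2 ℕ.* m ℕ.+ 2) C m)) ∎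
    where
    solve : ∀ x y → fromℕ 2 * (½ * (½ * x - ½ * (fromℕ 4 * y - x))) ≡ x - fromℕ 2 * y
    solve = solve-∀ ℚ-ring
    cancel : ∀ x y → x + y - y ≡ x
    cancel = solve-∀ ℚ-ring

  odd-coefficients : sq (λ m → Tₛ (2 ℕ.* m ℕ.+ 1)) ≈ₛ fromℕ 2 ·ₛ ((sq Bₛ ⊛ sq Cₛ) ⊛ sq Cₛ)
  odd-coefficients n = begin
    sq (λ m → Tₛ (2 ℕ.* m ℕ.+ 1)) n                ≡⟨ sq-cong T-odd-convolution n ⟩
    sq (fromℕ 2 ·ₛ ((Bₛ ⊛ Cₛ) ⊛ Cₛ)) n             ≡⟨ sq-scale (fromℕ 2) ((Bₛ ⊛ Cₛ) ⊛ Cₛ) n ⟩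
    fromℕ 2 * sq ((Bₛ ⊛ Cₛ) ⊛ Cₛ) n                ≡⟨ cong (fromℕ 2 *_) (sq-⊛ (Bₛ ⊛ Cₛ) Cₛ n) ⟨
    fromℕ 2 * (sq (Bₛ ⊛ Cₛ) ⊛ sq Cₛ) n             ≡⟨ cong (fromℕ 2 *_) (⊛-congˡ (sq-⊛ Bₛ Cₛ) (sq Cₛ) n) ⟨
    fromℕ 2 * ((sq Bₛ ⊛ sq Cₛ) ⊛ sq Cₛ) n          ∎

  odd-part : Xₛ ⊛ sq (λ m → Tₛ (2 ℕ.* m ℕ.+ 1)) ≈ₛ fromℕ 2 ·ₛ Xₛ ⊛ sq Bₛ ⊛ sq Cₛ ⊛ sq Cₛ
  odd-part n = trans (⊛-congʳ Xₛ odd-coefficients n) (X⊛-scaled-regroup (fromℕ 2) (sq Bₛ) (sq Cₛ) (sq Cₛ) n)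

module Averages where
  open RationalArithmetic
  open CatalanSeries using (C-quotient; central-recurrenceℚ)
  open TSeries using (T-even; T-odd)
  open BinomialFacts using (central; middle-symmetry; shifted-absorption)
  open PathNumbers using (paths⁺; symCount≡paths⁺)
  open PathNumberFormulas using (paths⁺-even; paths⁺-odd; paths⁺-positive)
  open import Data.Nat as ℕ using (ℕ; suc; _≤_)
  import Data.Nat.Properties as ℕP
  open import Data.Nat.Combinatorics using (_C_)
  open import Data.Nat.Tactic.RingSolver as ℕSolver using ()
  open import Data.Integer using (+_)
  open import Data.Rational using (ℚ; 0ℚ; 1ℚ; _+_; _*_; _-_; -_; _/_; _<_; ∣_∣)
  import Data.Rational.Properties as ℚP
  open import Data.Product using (∃-syntax; _,_; proj₂)
  open import Tactic.RingSolver using (solve-∀)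
  open ≡-Reasoning

  symCount-even : ∀ m → symCount (2 ℕ.* m) ≡ central m
  symCount-even m = trans (symCount≡paths⁺ (2 ℕ.* m)) (paths⁺-even m)

  symCount-odd : ∀ m → symCount (2 ℕ.* m ℕ.+ 1) ≡ (2 ℕ.* m ℕ.+ 1) C m
  symCount-odd m = begin
    symCount (2 ℕ.* m ℕ.+ 1)          ≡⟨ symCount≡paths⁺ (2 ℕ.* m ℕ.+ 1) ⟩
    paths⁺ (2 ℕ.* m ℕ.+ 1) 0          ≡⟨ cong (λ z → paths⁺ z 0) (ℕP.+-comm (2 ℕ.* m) 1) ⟩
    paths⁺ (suc (2 ℕ.* m)) 0          ≡⟨ paths⁺-odd m ⟩
    suc (2 ℕ.* m) C suc m             ≡⟨ middle-symmetry m ⟨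
    suc (2 ℕ.* m) C m                 ≡⟨ cong (_C m) (ℕP.+-comm 1 (2 ℕ.* m)) ⟩
    (2 ℕ.* m ℕ.+ 1) C m               ∎

  -- the average is x as soon as x · symCount n = T n (there is always a path)
  average-from : ∀ n x → x * fromℕ (symCount n) ≡ Tₛ n → average n ≡ x
  average-from n x = divℕ-unique′ (Tₛ n) (symCount n) x (trans (symCount≡paths⁺ n) (proj₂ (paths⁺-positive n 0)))

  average-even-binomial : ∀ m → average (2 ℕ.* m)
    ≡ divℕ (fromℕ ((2 ℕ.* m ℕ.+ 2) C (m ℕ.+ 1)) - divℕ (fromℕ ((2 ℕ.* m) C m)) (m ℕ.+ 1)) ((2 ℕ.* m) C m)
  average-even-binomial m = begin
    divℕ (Tₛ (2 ℕ.* m)) (symCount (2 ℕ.* m))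
      ≡⟨ cong₂ divℕ (T-even m) (symCount-even m) ⟩
    divℕ (Bₛ (suc m) - Cₛ m) (central m)
      ≡⟨ cong (λ z → divℕ (Bₛ (suc m) - z) (central m)) (C-quotient m) ⟩
    divℕ (Bₛ (suc m) - divℕ (Bₛ m) (suc m)) (central m)
      ≡⟨ cong₂ (λ k l → divℕ (fromℕ (k C l) - divℕ (Bₛ m) l) (central m)) (double-suc′ m) (ℕP.+-comm 1 m) ⟩
    divℕ (fromℕ ((2 ℕ.* m ℕ.+ 2) C (m ℕ.+ 1)) - divℕ (Bₛ m) (m ℕ.+ 1)) (central m) ∎
    where
    double-suc′ : ∀ m → 2 ℕ.* suc m ≡ 2 ℕ.* m ℕ.+ 2
    double-suc′ = ℕSolver.solve-∀

  central-suc-ratio : ∀ m → Bₛ (suc m) ≡ fromℕ 2 * (fromℕ 2 * fromℕ m + 1ℚ) * Bₛ m * recip m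
  central-suc-ratio m = begin
    Bₛ (suc m)                                      ≡⟨ ℚP.*-identityʳ _ ⟨
    Bₛ (suc m) * 1ℚ                                 ≡⟨ cong (Bₛ (suc m) *_) (recip-inverse m) ⟨
    Bₛ (suc m) * (fromℕ (suc m) * recip m)          ≡⟨ reassociate (Bₛ (suc m)) (fromℕ (suc m)) (recip m) ⟩
    (fromℕ (suc m) * Bₛ (suc m)) * recip m          ≡⟨ cong (_* recip m) (central-recurrenceℚ m) ⟩
    fromℕ 2 * (fromℕ 2 * fromℕ m + 1ℚ) * Bₛ m * recip m ∎
    where
    reassociate : ∀ x y z → x * (y * z) ≡ (y * x) * z
    reassociate = solve-∀ ℚ-ring

  average-even : ∀ m → average (2 ℕ.* m) ≡ + (4 ℕ.* m ℕ.+ 1) / suc m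
  average-even m = average-from (2 ℕ.* m) (+ (4 ℕ.* m ℕ.+ 1) / suc m) (begin
    + (4 ℕ.* m ℕ.+ 1) / suc m * fromℕ (symCount (2 ℕ.* m))
      ≡⟨ cong₂ _*_ (trans (/-as-recip (4 ℕ.* m ℕ.+ 1) m) (cong (_* recip m) (fromℕ-*+ 4 m 1)))
                   (cong fromℕ (symCount-even m)) ⟩
    (fromℕ 4 * fromℕ m + 1ℚ) * recip m * Bₛ m
      ≡⟨ split (fromℕ m) (recip m) (Bₛ m) ⟩
    fromℕ 2 * (fromℕ 2 * fromℕ m + 1ℚ) * Bₛ m * recip m - Bₛ m * recip m
      ≡⟨ cong (_- Bₛ m * recip m) (central-suc-ratio m) ⟨
    Bₛ (suc m) - divℕ (Bₛ m) (suc m)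
      ≡⟨ cong (λ z → Bₛ (suc m) - z) (C-quotient m) ⟨
    Bₛ (suc m) - Cₛ m
      ≡⟨ T-even m ⟨
    Tₛ (2 ℕ.* m) ∎)
    where
    split : ∀ M r B → (fromℕ 4 * M + 1ℚ) * r * B ≡ fromℕ 2 * (fromℕ 2 * M + 1ℚ) * B * r - B * r
    split = solve-∀ ℚ-ring

  average-odd-binomial : ∀ m → average (2 ℕ.* m ℕ.+ 1)
    ≡ divℕ (fromℕ (2 ℕ.* ((2 ℕ.* m ℕ.+ 2) C m))) ((2 ℕ.* m ℕ.+ 1) C m)
  average-odd-binomial m = cong₂ divℕ (T-odd m) (symCount-odd m)

  -- 4(m+1)/(m+2) · C(2m+1,m) = 2 C(2m+2,m), by (m+2) C(2m+2,m) = 2(m+1) C(2m+1,m)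
  average-odd : ∀ m → average (2 ℕ.* m ℕ.+ 1) ≡ + (4 ℕ.* (m ℕ.+ 1)) / suc (suc m)
  average-odd m = average-from (2 ℕ.* m ℕ.+ 1) (+ (4 ℕ.* (m ℕ.+ 1)) / suc (suc m)) (begin
    + (4 ℕ.* (m ℕ.+ 1)) / suc (suc m) * fromℕ (symCount (2 ℕ.* m ℕ.+ 1))
      ≡⟨ cong₂ _*_ (trans (/-as-recip (4 ℕ.* (m ℕ.+ 1)) (suc m))
                          (cong (_* recip (suc m)) (trans (cong fromℕ (four m)) (fromℕ-* 2 (2 ℕ.* suc m)))))
                   (cong fromℕ (symCount-odd m)) ⟩
    fromℕ 2 * fromℕ (2 ℕ.* suc m) * recip (suc m) * fromℕ K
      ≡⟨ regroup (fromℕ 2) (fromℕ (2 ℕ.* suc m)) (recip (suc m)) (fromℕ K) ⟩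
    fromℕ 2 * (fromℕ (2 ℕ.* suc m) * fromℕ K) * recip (suc m)
      ≡⟨ cong (λ z → fromℕ 2 * z * recip (suc m)) absorbed ⟩
    fromℕ 2 * (fromℕ (suc (suc m)) * fromℕ X) * recip (suc m)
      ≡⟨ regroup′ (fromℕ 2) (fromℕ (suc (suc m))) (fromℕ X) (recip (suc m)) ⟩
    fromℕ 2 * fromℕ X * (fromℕ (suc (suc m)) * recip (suc m))
      ≡⟨ cong (fromℕ 2 * fromℕ X *_) (recip-inverse (suc m)) ⟩
    fromℕ 2 * fromℕ X * 1ℚ
      ≡⟨ trans (ℚP.*-identityʳ _) (sym (fromℕ-* 2 X)) ⟩
    fromℕ (2 ℕ.* X)
      ≡⟨ T-odd m ⟨
    Tₛ (2 ℕ.* m ℕ.+ 1) ∎)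
    where
    X = (2 ℕ.* m ℕ.+ 2) C m
    K = (2 ℕ.* m ℕ.+ 1) C m
    four : ∀ m → 4 ℕ.* (m ℕ.+ 1) ≡ 2 ℕ.* (2 ℕ.* suc m)
    four = ℕSolver.solve-∀
    absorbed : fromℕ (2 ℕ.* suc m) * fromℕ K ≡ fromℕ (suc (suc m)) * fromℕ X
    absorbed = trans (sym (fromℕ-* (2 ℕ.* suc m) K))
                     (trans (cong fromℕ (sym (shifted-absorption m))) (fromℕ-* (suc (suc m)) X))
    regroup : ∀ a b c d → a * b * c * d ≡ a * (b * d) * c
    regroup = solve-∀ ℚ-ring
    regroup′ : ∀ a b c d → a * (b * c) * d ≡ a * c * (b * d)
    regroup′ = solve-∀ ℚ-ring

  converges : ∀ (a : ℕ → ℚ) L c s → (∀ m → ∣ a m - L ∣ ≡ + c / suc (s ℕ.+ m)) →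
              ∀ (ε : ℚ) → 0ℚ < ε → ∃[ N ] (∀ m → N ≤ m → ∣ a m - L ∣ < ε)
  converges a L c s distance ε ε>0 with fraction-vanishes c ε ε>0
  ... | N , small = N , λ m N≤m → subst (_< ε) (sym (distance m)) (small (s ℕ.+ m) (ℕP.m≤n⇒m≤o+n s N≤m))

  distance-even : ∀ m → ∣ average (2 ℕ.* m) - fromℕ 4 ∣ ≡ + 3 / suc m
  distance-even m = begin
    ∣ average (2 ℕ.* m) - fromℕ 4 ∣
      ≡⟨ cong (λ z → ∣ z - fromℕ 4 ∣) (trans (average-even m)
           (trans (/-as-recip (4 ℕ.* m ℕ.+ 1) m) (cong (_* r) (fromℕ-*+ 4 m 1)))) ⟩
    ∣ (fromℕ 4 * fromℕ m + 1ℚ) * r - fromℕ 4 ∣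
      ≡⟨ cong (λ z → ∣ (fromℕ 4 * fromℕ m + 1ℚ) * r - z ∣)
              (trans (sym (ℚP.*-identityʳ (fromℕ 4)))
                     (cong (fromℕ 4 *_) (trans (sym (recip-inverse m)) (cong (_* r) (fromℕ-suc m))))) ⟩
    ∣ (fromℕ 4 * fromℕ m + 1ℚ) * r - fromℕ 4 * ((fromℕ m + 1ℚ) * r) ∣
      ≡⟨ cong ∣_∣ (solve (fromℕ m) r) ⟩
    ∣ - (fromℕ 3 * r) ∣
      ≡⟨ cong (λ z → ∣ - z ∣) (/-as-recip 3 m) ⟨
    ∣ - (+ 3 / suc m) ∣
      ≡⟨ ∣-fraction∣ 3 m ⟩
    + 3 / suc m ∎
    where
    r = recip m
    solve : ∀ M r → (fromℕ 4 * M + 1ℚ) * r - fromℕ 4 * ((M + 1ℚ) * r) ≡ - (fromℕ 3 * r)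
    solve = solve-∀ ℚ-ring

  distance-odd : ∀ m → ∣ average (2 ℕ.* m ℕ.+ 1) - fromℕ 4 ∣ ≡ + 4 / suc (suc m)
  distance-odd m = begin
    ∣ average (2 ℕ.* m ℕ.+ 1) - fromℕ 4 ∣
      ≡⟨ cong (λ z → ∣ z - fromℕ 4 ∣) (trans (average-odd m)
           (trans (/-as-recip (4 ℕ.* (m ℕ.+ 1)) (suc m))
                  (cong (_* r) (trans (cong fromℕ (ℕP.*-distribˡ-+ 4 m 1)) (fromℕ-*+ 4 m 4))))) ⟩
    ∣ (fromℕ 4 * fromℕ m + fromℕ 4) * r - fromℕ 4 ∣
      ≡⟨ cong (λ z → ∣ (fromℕ 4 * fromℕ m + fromℕ 4) * r - z ∣)
              (trans (sym (ℚP.*-identityʳ (fromℕ 4)))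
                     (cong (fromℕ 4 *_) (trans (sym (recip-inverse (suc m))) (cong (_* r) two-more)))) ⟩
    ∣ (fromℕ 4 * fromℕ m + fromℕ 4) * r - fromℕ 4 * ((fromℕ m + fromℕ 2) * r) ∣
      ≡⟨ cong ∣_∣ (solve (fromℕ m) r) ⟩
    ∣ - (fromℕ 4 * r) ∣
      ≡⟨ cong (λ z → ∣ - z ∣) (/-as-recip 4 (suc m)) ⟨
    ∣ - (+ 4 / suc (suc m)) ∣
      ≡⟨ ∣-fraction∣ 4 (suc m) ⟩
    + 4 / suc (suc m) ∎
    where
    r = recip (suc m)
    two-more : fromℕ (suc (suc m)) ≡ fromℕ m + fromℕ 2
    two-more = trans (cong fromℕ (ℕP.+-comm 2 m)) (fromℕ-+ m 2)
    solve : ∀ M r → (fromℕ 4 * M + fromℕ 4) * r - fromℕ 4 * ((M + fromℕ 2) * r) ≡ - (fromℕ 4 * r)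
    solve = solve-∀ ℚ-ring

  average-even-limit : ∀ (ε : ℚ) → 0ℚ < ε → ∃[ N ] (∀ m → N ≤ m → ∣ average (2 ℕ.* m) - fromℕ 4 ∣ < ε)
  average-even-limit = converges (λ m → average (2 ℕ.* m)) (fromℕ 4) 3 0 distance-even

  average-odd-limit : ∀ (ε : ℚ) → 0ℚ < ε → ∃[ N ] (∀ m → N ≤ m → ∣ average (2 ℕ.* m ℕ.+ 1) - fromℕ 4 ∣ < ε)
  average-odd-limit = converges (λ m → average (2 ℕ.* m ℕ.+ 1)) (fromℕ 4) 4 1 distance-odd

open import Data.Nat using (suc; _≤_; _*_; _+_)
open import Data.Nat.Combinatorics using (_C_)
open import Data.Integer using (+_)
open import Data.Rational using (ℚ; 0ℚ; ½; _/_; _<_; _-_; ∣_∣)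
open import Data.List using ([]; _∷_; map; upTo)
open import Data.Product using (_×_; ∃-syntax; _,_)

theorem4p5 :
      (Tₛ ≈ₛ (fromℕ 2 ·ₛ sq Cₛ) ⊛ (½ ·ₛ divX (sqrtₛ ((oneₛ ⊕ fromℕ 2 ·ₛ Xₛ) ⊛ invₛ (oneₛ ⊖ fromℕ 2 ·ₛ Xₛ)) ⊖ oneₛ)) ⊖ sq Cₛ)
    × (map T (upTo 8) ≡ 1 ∷ 2 ∷ 5 ∷ 8 ∷ 18 ∷ 30 ∷ 65 ∷ 112 ∷ [])
    × (sq (λ m → Tₛ (2 * m)) ≈ₛ sq Cₛ ⊛ (fromℕ 2 ·ₛ sq Bₛ ⊖ oneₛ))
    × (∀ m → average (2 * m) ≡ divℕ (fromℕ ((2 * m + 2) C (m + 1)) - divℕ (fromℕ ((2 * m) C m)) (m + 1)) ((2 * m) C m))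
    × (∀ m → average (2 * m) ≡ + (4 * m + 1) / suc m)
    × (∀ (ε : ℚ) → 0ℚ < ε → ∃[ N ] (∀ m → N ≤ m → ∣ average (2 * m) - fromℕ 4 ∣ < ε))
    × (Xₛ ⊛ sq (λ m → Tₛ (2 * m + 1)) ≈ₛ fromℕ 2 ·ₛ Xₛ ⊛ sq Bₛ ⊛ sq Cₛ ⊛ sq Cₛ)
    × (∀ m → average (2 * m + 1) ≡ divℕ (fromℕ (2 * ((2 * m + 2) C m))) ((2 * m + 1) C m))
    × (∀ m → average (2 * m + 1) ≡ + (4 * (m + 1)) / suc (suc m))
    × (∀ (ε : ℚ) → 0ℚ < ε → ∃[ N ] (∀ m → N ≤ m → ∣ average (2 * m + 1) - fromℕ 4 ∣ < ε))
theorem4p5 =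
    TSeries.generating-function
  , TSeries.first-values
  , TSeries.even-part
  , Averages.average-even-binomial
  , Averages.average-even
  , Averages.average-even-limit
  , TSeries.odd-part
  , Averages.average-odd-binomial
  , Averages.average-odd
  , Averages.average-odd-limit
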